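{- Let $k\geq 1$. For every $n\geq 1$, \[ M_k(n)=\sum_{i=1}^{n-1}\sum_{j=1}^{n-i}u_iu_jk^{2n-2(i+j)}+\sum_{i=1}^{\lfloor n/3\rfloor}\big(U_k(i)-u_i\big)\sum_{j=2i}^{n-i}G_i(j)\,G_i(n-j+i),\] with $M_k(1)=0$. Moreover, \[ R_k(n)=\Big(\sum_{i=1}^{n-1}k^{2n-2i}u_i\Big)-M_k(n)\quad\text{and}\quad U_k(n)+2R_k(n)+M_k(n)=k^{2n}.\]
   Context: $\Sigma_k=\{0,1,\ldots,k-1\}$ and $\Sigma_k^n$ is the set of length-$n$ words over $\Sigma_k$. A border of a word $w$ is a non-empty word that is both a proper prefix and a proper suffix of $w$; $w$ is unbordered if it has no border. $u_m$ denotes the number of unbordered words in $\Sigma_k^m$. For a pair of words $(u,v)$: a right-border is a non-empty word that is a proper suffix of $u$ and a proper prefix of $v$; a left-border is a non-empty word that is a proper prefix of $u$ and a proper suffix of $v$. The pair is mutually bordered if it has both a right-border and a left-border, mutually unbordered if it has neither, and right-bordered if it has a right-border but no left-border. $M_k(n)$, $R_k(n)$, $U_k(n)$ denote respectively the numbers of mutually bordered, right-bordered, and mutually unbordered pairs $(u,v)\in\Sigma_k^n\times\Sigma_k^n$. For integers $t\geq 1$ and $m\geq 0$, $G_t(m)$ is defined by $G_t(m)=0$ if $m<2t$ and $G_t(m)=k^{m-2t}-\sum_{i=2t}^{\lfloor m/2\rfloor}G_t(i)k^{m-2i}$ if $m\geq 2t$ (this equals the number of unbordered length-$m$ words with a prescribed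 prefix $x$ and suffix $y$, where $x\neq y$ are length-$t$ words with $(x,y)$ mutually unbordered). -}

module Defs where

open import Data.Nat as ℕ using (ℕ; zero; suc; _∸_; _<?_)
open import Data.Fin using (Fin)
open import Data.Fin.Properties using () renaming (_≟_ to _≟F_)
open import Data.List using (List; []; _∷_; [_]; map; concatMap; take; drop; length;
  filter; cartesianProduct; applyUpTo; allFin; sum)
open import Data.List.Properties using (≡-dec)
open import Data.List.Relation.Unary.Any using (Any; any?)
open import Data.Product using (_×_; _,_; proj₁; proj₂)
open import Data.Integer as ℤ using (ℤ; +_)
open import Relation.Binary.PropositionalEquality using (_≡_)
open import Relation.Nullary using (¬_; Dec; yes; no)
open import Relation.Nullary.Decidable using (¬?; _×-dec_)

Word : ℕ → Set
Word k = List (Fin k)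

_≟W_ : ∀ {k} → (x y : Word k) → Dec (x ≡ y)
_≟W_ = ≡-dec _≟F_

words : (k n : ℕ) → List (Word k)
words k zero    = [ [] ]
words k (suc n) = concatMap (λ a → map (a ∷_) (words k n)) (allFin k)

wordPairs : (k n : ℕ) → List (Word k × Word k)
wordPairs k n = cartesianProduct (words k n) (words k n)

properLengths : ℕ → List ℕ
properLengths m = applyUpTo suc (m ∸ 1)

PreSuf : ∀ {k} → Word k → Word k → ℕ → Set
PreSuf u v l = take l u ≡ drop (length v ∸ l) v

Bordered : ∀ {k} → Word k → Set
Bordered w = Any (PreSuf w w) (properLengths (length w))

Unbordered : ∀ {k} → Word k → Set
Unbordered w = ¬ Bordered w

-- (u,v) has a right-border: non-empty proper suffix of u which is a proper prefix of v
-- (proper with respect to both words)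
HasRightBorder : ∀ {k} → Word k × Word k → Set
HasRightBorder (u , v) = Any (PreSuf v u) (properLengths (length u ℕ.⊓ length v))

HasLeftBorder : ∀ {k} → Word k × Word k → Set
HasLeftBorder (u , v) = Any (PreSuf u v) (properLengths (length u ℕ.⊓ length v))

MutuallyBordered : ∀ {k} → Word k × Word k → Set
MutuallyBordered p = HasRightBorder p × HasLeftBorder p

MutuallyUnbordered : ∀ {k} → Word k × Word k → Set
MutuallyUnbordered p = ¬ HasRightBorder p × ¬ HasLeftBorder p

RightBordered : ∀ {k} → Word k × Word k → Set
RightBordered p = HasRightBorder p × ¬ HasLeftBorder p

bordered? : ∀ {k} (w : Word k) → Dec (Bordered w)
bordered? w = any? (λ l → take l w ≟W drop (length w ∸ l) w) (properLengths (length w))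

hasRB? : ∀ {k} (p : Word k × Word k) → Dec (HasRightBorder p)
hasRB? (u , v) = any? (λ l → take l v ≟W drop (length u ∸ l) u)
                      (properLengths (length u ℕ.⊓ length v))

hasLB? : ∀ {k} (p : Word k × Word k) → Dec (HasLeftBorder p)
hasLB? (u , v) = any? (λ l → take l u ≟W drop (length v ∸ l) v)
                      (properLengths (length u ℕ.⊓ length v))

u : (k m : ℕ) → ℕ
u k m = length (filter (λ w → ¬? (bordered? w)) (words k m))

M : (k n : ℕ) → ℕ
M k n = length (filter (λ p → hasRB? p ×-dec hasLB? p) (wordPairs k n))

R : (k n : ℕ) → ℕ
R k n = length (filter (λ p → hasRB? p ×-dec ¬? (hasLB? p)) (wordPairs k n))

U : (k n : ℕ) → ℕ
U k n = length (filter (λ p → ¬? (hasRB? p) ×-dec ¬? (hasLB? p)) (wordPairs k n))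

-- Σ_{i=a}^{b} f i  (empty, i.e. 0, when b < a)
range : ℕ → ℕ → List ℕ
range a b = applyUpTo (a ℕ.+_) (suc b ∸ a)

∑[_⋯_] : ℕ → ℕ → (ℕ → ℤ) → ℤ
∑[ a ⋯ b ] f = Data.List.foldr ℤ._+_ (+ 0) (map f (range a b))

-- G_t(m) (depending on k), computed with a fuel argument; the recursive calls are at
-- i ≤ ⌊m/2⌋ < m, so fuel m+1 is always sufficient and G below is exactly the
-- recursively defined G_t(m) of the paper.
Gfuel : (k t : ℕ) → ℕ → ℕ → ℤ
Gfuel k t zero       m = + 0
Gfuel k t (suc fuel) m with m <? 2 ℕ.* t
... | yes _ = + 0
... | no  _ = + (k ℕ.^ (m ∸ 2 ℕ.* t))
              ℤ.- ∑[ 2 ℕ.* t ⋯ m ℕ./ 2 ] (λ i → Gfuel k t fuel i ℤ.* + (k ℕ.^ (m ∸ 2 ℕ.* i)))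

G : (k t m : ℕ) → ℤ
G k t m = Gfuel k t (suc m) m

-- A pair (u , v) has a right border iff it has a shortest one, and the shortest one is unbordered;
-- so mutually bordered pairs are classified by the lengths i and j of their shortest right and left borders.
-- If i + j ≤ n the two borders occupy disjoint positions and the rest of u and v is free:
-- u_i u_j k^(2n-2(i+j)) pairs.  If i + j > n they overlap in o = i + j - n letters: the right border
-- runs from a word d to a word g of length o and the left border from g to d, where (d , g) is one
-- of the U_k(o) - u_o mutually unbordered pairs with d ≢ g.  The unbordered words of length m from d
-- to g are counted by G_o(m): from the k^(m-2o) words from d to g remove the bordered ones, classified
-- by the length ℓ of their shortest border, which is forced into 2o ≤ ℓ ≤ m/2.
-- Counting pairs by the shortest right border alone gives R + M, and U + 2R + M = k^(2n) because
-- (u , v) ↦ (v , u) exchanges right- and left-bordered pairs.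

module Submission where

open import Defs
open import Data.Nat as ℕ using (ℕ; zero; suc; _+_; _*_; _∸_; _^_; _≤_; _<_; z≤n; s≤s; z<s; s<s; _⊓_;
  _≤?_; _<?_)
open import Data.Nat.Properties
open import Data.Nat.DivMod using (_/_; _%_; m/n*n≤m; m≡m%n+[m/n]*n; m%n<n; m/n<m)
open import Data.Nat.ListAction using (sum)
open import Data.Nat.ListAction.Properties using (sum-++)
open import Data.Nat.Tactic.RingSolver using (solve-∀)
open import Data.Integer as ℤ using (ℤ)
import Data.Integer.Properties as ℤ
open import Data.Fin as Fin using (Fin)
import Data.Fin.Properties as Fin
open import Data.List using (List; []; _∷_; [_]; map; foldr; concatMap; take; drop; length;
  filter; cartesianProduct; applyUpTo; allFin; _++_)
open import Data.List.Properties hiding (sum-++)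
open import Data.List.Relation.Unary.Any using (Any; any?; here)
import Data.List.Relation.Unary.Any.Properties as Any
open import Data.Product using (_×_; _,_; proj₁; proj₂; ∃)
open import Data.Sum using (_⊎_; inj₁; inj₂)
open import Data.Empty using (⊥; ⊥-elim)
open import Function using (_∘_; id)
open import Relation.Binary using (tri<; tri≈; tri>)
open import Relation.Binary.PropositionalEquality hiding ([_])
open import Relation.Nullary using (¬_; Dec; yes; no)
open import Relation.Nullary.Decidable using (¬?; _×-dec_)

-- Indicators and finite sums

χ : ∀ {p} {P : Set p} → Dec P → ℕ
χ (yes _) = 1
χ (no _)  = 0

module _ {p q} {P : Set p} {Q : Set q} where

  χ-cong : (P → Q) → (Q → P) → (d : Dec P) (e : Dec Q) → χ d ≡ χ e
  χ-cong f g (yes p) (yes q) = refl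
  χ-cong f g (yes p) (no ¬q) = ⊥-elim (¬q (f p))
  χ-cong f g (no ¬p) (yes q) = ⊥-elim (¬p (g q))
  χ-cong f g (no ¬p) (no ¬q) = refl

  χ-× : (d : Dec P) (e : Dec Q) → χ (d ×-dec e) ≡ χ d * χ e
  χ-× (yes _) (yes _) = refl
  χ-× (yes _) (no _)  = refl
  χ-× (no _)  _       = refl

  χ-×¬+χ-× : (d : Dec P) (e : Dec Q) → χ (d ×-dec ¬? e) + χ (d ×-dec e) ≡ χ d
  χ-×¬+χ-× (yes _) (yes _) = refl
  χ-×¬+χ-× (yes _) (no _)  = refl
  χ-×¬+χ-× (no _)  _       = refl

  χ-partition : (d : Dec P) (e : Dec Q) →
    χ (¬? d ×-dec ¬? e) + χ (d ×-dec ¬? e) + χ (¬? d ×-dec e) + χ (d ×-dec e) ≡ 1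
  χ-partition (yes _) (yes _) = refl
  χ-partition (yes _) (no _)  = refl
  χ-partition (no _)  (yes _) = refl
  χ-partition (no _)  (no _)  = refl

module _ {p} {P : Set p} where

  χ-yes : P → (d : Dec P) → χ d ≡ 1
  χ-yes p (yes _) = refl
  χ-yes p (no ¬p) = ⊥-elim (¬p p)

  χ-no : ¬ P → (d : Dec P) → χ d ≡ 0
  χ-no ¬p (yes p) = ⊥-elim (¬p p)
  χ-no ¬p (no _)  = refl

  χ-¬+χ : (d : Dec P) → χ (¬? d) + χ d ≡ 1
  χ-¬+χ (yes _) = refl
  χ-¬+χ (no _)  = refl

  χ≢0⇒ : (d : Dec P) → χ d ≢ 0 → P
  χ≢0⇒ (yes p) _  = p
  χ≢0⇒ (no _)  ne = ⊥-elim (ne refl)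

χ-≡ : ∀ {P Q : Set} → P ≡ Q → (d : Dec P) (e : Dec Q) → χ d ≡ χ e
χ-≡ refl = χ-cong id id

χ-×-cong : ∀ {P₁ P₂ Q₁ Q₂ : Set} (d₁ : Dec P₁) (d₂ : Dec P₂) (e₁ : Dec Q₁) (e₂ : Dec Q₂) →
  (P₁ → P₂ → Q₁ × Q₂) → (Q₁ → Q₂ → P₁ × P₂) → χ d₁ * χ d₂ ≡ χ e₁ * χ e₂
χ-×-cong d₁ d₂ e₁ e₂ f g = trans (sym (χ-× d₁ d₂)) (trans
  (χ-cong (λ (a , b) → f a b) (λ (a , b) → g a b) (d₁ ×-dec d₂) (e₁ ×-dec e₂)) (χ-× e₁ e₂))

sumMap : ∀ {a} {A : Set a} → (A → ℕ) → List A → ℕ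
sumMap f xs = sum (map f xs)

module _ {a} {A : Set a} where

  sumMap-cong : ∀ {f g : A → ℕ} xs → (∀ x → f x ≡ g x) → sumMap f xs ≡ sumMap g xs
  sumMap-cong []       e = refl
  sumMap-cong (x ∷ xs) e = cong₂ _+_ (e x) (sumMap-cong xs e)

  sumMap-+ : ∀ (f g : A → ℕ) xs → sumMap (λ x → f x + g x) xs ≡ sumMap f xs + sumMap g xs
  sumMap-+ f g []       = refl
  sumMap-+ f g (x ∷ xs) = begin
    f x + g x + sumMap (λ x → f x + g x) xs ≡⟨ cong ((f x + g x) +_) (sumMap-+ f g xs) ⟩
    f x + g x + (sumMap f xs + sumMap g xs) ≡⟨ +-assoc-swap (f x) (g x) (sumMap f xs) (sumMap g xs) ⟩
    f x + sumMap f xs + (g x + sumMap g xs) ∎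
    where
    open ≡-Reasoning
    +-assoc-swap : ∀ a b c d → a + b + (c + d) ≡ a + c + (b + d)
    +-assoc-swap = solve-∀

  sumMap-*ˡ : ∀ c (f : A → ℕ) xs → sumMap (λ x → c * f x) xs ≡ c * sumMap f xs
  sumMap-*ˡ c f []       = sym (*-zeroʳ c)
  sumMap-*ˡ c f (x ∷ xs) = trans (cong (c * f x +_) (sumMap-*ˡ c f xs)) (sym (*-distribˡ-+ c (f x) _))

  sumMap-*ʳ : ∀ c (f : A → ℕ) xs → sumMap (λ x → f x * c) xs ≡ sumMap f xs * c
  sumMap-*ʳ c f xs = begin
    sumMap (λ x → f x * c) xs ≡⟨ sumMap-cong xs (λ x → *-comm (f x) c) ⟩
    sumMap (λ x → c * f x) xs ≡⟨ sumMap-*ˡ c f xs ⟩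
    c * sumMap f xs           ≡⟨ *-comm c _ ⟩
    sumMap f xs * c           ∎
    where open ≡-Reasoning

  sumMap-const : ∀ c (xs : List A) → sumMap (λ _ → c) xs ≡ length xs * c
  sumMap-const c []       = refl
  sumMap-const c (x ∷ xs) = cong (c +_) (sumMap-const c xs)

  sumMap-≡0 : ∀ (f : A → ℕ) xs → (∀ x → f x ≡ 0) → sumMap f xs ≡ 0
  sumMap-≡0 f xs e = trans (sumMap-cong xs e) (trans (sumMap-const 0 xs) (*-zeroʳ (length xs)))

  sumMap-++ : ∀ (f : A → ℕ) xs ys → sumMap f (xs ++ ys) ≡ sumMap f xs + sumMap f ys
  sumMap-++ f xs ys = trans (cong sum (map-++ f xs ys)) (sum-++ (map f xs) (map f ys))

  sumMap≢0⇒∃ : ∀ (f : A → ℕ) xs → sumMap f xs ≢ 0 → ∃ λ x → f x ≢ 0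
  sumMap≢0⇒∃ f []       ne = ⊥-elim (ne refl)
  sumMap≢0⇒∃ f (x ∷ xs) ne with f x ℕ.≟ 0
  ... | no fx≢0 = x , fx≢0
  ... | yes fx≡0 = sumMap≢0⇒∃ f xs (λ e → ne (trans (cong (_+ sumMap f xs) fx≡0) e))

  length-filter≡sumMap-χ : ∀ {p} {P : A → Set p} (P? : ∀ x → Dec (P x)) xs →
    length (filter P? xs) ≡ sumMap (λ x → χ (P? x)) xs
  length-filter≡sumMap-χ P? [] = refl
  length-filter≡sumMap-χ P? (x ∷ xs) with P? x
  ... | yes _ = cong suc (length-filter≡sumMap-χ P? xs)
  ... | no _  = length-filter≡sumMap-χ P? xs

sumMap-map : ∀ {a b} {A : Set a} {B : Set b} (f : B → ℕ) (g : A → B) xs →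
  sumMap f (map g xs) ≡ sumMap (f ∘ g) xs
sumMap-map f g xs = cong sum (sym (map-∘ xs))

module _ {a b} {A : Set a} {B : Set b} where

  sumMap-comm : ∀ (f : A → B → ℕ) xs ys →
    sumMap (λ x → sumMap (f x) ys) xs ≡ sumMap (λ y → sumMap (λ x → f x y) xs) ys
  sumMap-comm f []       ys = sym (sumMap-≡0 _ ys (λ _ → refl))
  sumMap-comm f (x ∷ xs) ys =
    trans (cong (sumMap (f x) ys +_) (sumMap-comm f xs ys)) (sym (sumMap-+ (f x) _ ys))

  sumMap-concatMap : ∀ (f : B → ℕ) (g : A → List B) xs →
    sumMap f (concatMap g xs) ≡ sumMap (λ x → sumMap f (g x)) xs
  sumMap-concatMap f g []       = refl
  sumMap-concatMap f g (x ∷ xs) =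
    trans (sumMap-++ f (g x) (concatMap g xs)) (cong (sumMap f (g x) +_) (sumMap-concatMap f g xs))

  sumMap-cartesianProduct : ∀ (f : A × B → ℕ) xs ys →
    sumMap f (cartesianProduct xs ys) ≡ sumMap (λ x → sumMap (λ y → f (x , y)) ys) xs
  sumMap-cartesianProduct f []       ys = refl
  sumMap-cartesianProduct f (x ∷ xs) ys = trans (sumMap-++ f (map (x ,_) ys) _)
    (cong₂ _+_ (sumMap-map f (x ,_) ys) (sumMap-cartesianProduct f xs ys))

sumMap-allFin-χ≟ : ∀ k (b : Fin k) → sumMap (λ a → χ (a Fin.≟ b)) (allFin k) ≡ 1
sumMap-allFin-χ≟ (suc k) b = begin
  sumMap χ≟b (allFin (suc k))
    ≡⟨ cong (λ as → χ (Fin.zero Fin.≟ b) + sumMap χ≟b as) (sym (map-tabulate id Fin.suc)) ⟩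
  χ (Fin.zero Fin.≟ b) + sumMap χ≟b (map Fin.suc (allFin k))
    ≡⟨ cong (χ (Fin.zero Fin.≟ b) +_) (sumMap-map χ≟b Fin.suc (allFin k)) ⟩
  χ (Fin.zero Fin.≟ b) + sumMap (λ a → χ (Fin.suc a Fin.≟ b)) (allFin k) ≡⟨ split b ⟩
  1 ∎
  where
  open ≡-Reasoning
  χ≟b : Fin (suc k) → ℕ
  χ≟b a = χ (a Fin.≟ b)
  split : ∀ b → χ (Fin.zero Fin.≟ b) + sumMap (λ a → χ (Fin.suc a Fin.≟ b)) (allFin k) ≡ 1
  split Fin.zero    = cong suc (sumMap-≡0 _ (allFin k) (λ a → χ-no (λ ()) (Fin.suc a Fin.≟ Fin.zero)))
  split (Fin.suc b) = trans
    (sumMap-cong (allFin k) (λ a → χ-cong Fin.suc-injective (cong Fin.suc) (Fin.suc a Fin.≟ Fin.suc b) (a Fin.≟ b)))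
    (sumMap-allFin-χ≟ k b)

sumMap-applyUpTo-cong : ∀ n (g h : ℕ → ℕ) (f f′ : ℕ → ℕ) → (∀ i → i < n → f (g i) ≡ f′ (h i)) →
  sumMap f (applyUpTo g n) ≡ sumMap f′ (applyUpTo h n)
sumMap-applyUpTo-cong zero    g h f f′ e = refl
sumMap-applyUpTo-cong (suc n) g h f f′ e = cong₂ _+_ (e 0 z<s)
  (sumMap-applyUpTo-cong n (g ∘ suc) (h ∘ suc) f f′ (λ i i<n → e (suc i) (s<s i<n)))

sumFrom : ℕ → ℕ → (ℕ → ℕ) → ℕ
sumFrom a n f = sumMap f (applyUpTo (a +_) n)

sumFrom-cong : ∀ a n {f f′ : ℕ → ℕ} → (∀ i → a ≤ i → i < a + n → f i ≡ f′ i) →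
  sumFrom a n f ≡ sumFrom a n f′
sumFrom-cong a n {f} {f′} e =
  sumMap-applyUpTo-cong n (a +_) (a +_) f f′ (λ i i<n → e (a + i) (m≤m+n a i) (+-monoʳ-< a i<n))

sumFrom-shift : ∀ a b n (f : ℕ → ℕ) → sumFrom (b + a) n f ≡ sumFrom a n (λ i → f (b + i))
sumFrom-shift a b n f =
  sumMap-applyUpTo-cong n ((b + a) +_) (a +_) f _ (λ i _ → cong f (+-assoc b a i))

sumFrom-suc : ∀ a n f → sumFrom a (suc n) f ≡ f a + sumFrom (suc a) n f
sumFrom-suc a n f = cong₂ _+_ (cong f (+-identityʳ a))
  (sumMap-applyUpTo-cong n (λ i → a + suc i) (suc a +_) f f (λ i _ → cong f (+-suc a i)))

sumFrom-snoc : ∀ a n f → sumFrom a (suc n) f ≡ sumFrom a n f + f (a + n)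
sumFrom-snoc a n f = begin
  sumFrom a (suc n) f                        ≡⟨ cong (sumMap f) (sym (applyUpTo-∷ʳ (a +_) n)) ⟩
  sumMap f (applyUpTo (a +_) n ++ [ a + n ]) ≡⟨ sumMap-++ f (applyUpTo (a +_) n) [ a + n ] ⟩
  sumFrom a n f + (f (a + n) + 0)            ≡⟨ cong (sumFrom a n f +_) (+-identityʳ _) ⟩
  sumFrom a n f + f (a + n)                  ∎
  where open ≡-Reasoning

sumFrom-+ : ∀ a n f g → sumFrom a n (λ i → f i + g i) ≡ sumFrom a n f + sumFrom a n g
sumFrom-+ a n f g = sumMap-+ f g (applyUpTo (a +_) n)

sumFrom-*ˡ : ∀ a n c f → sumFrom a n (λ i → c * f i) ≡ c * sumFrom a n f
sumFrom-*ˡ a n c f = sumMap-*ˡ c f (applyUpTo (a +_) n)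

sumFrom-*ʳ : ∀ a n c f → sumFrom a n (λ i → f i * c) ≡ sumFrom a n f * c
sumFrom-*ʳ a n c f = sumMap-*ʳ c f (applyUpTo (a +_) n)

sumFrom-≡0 : ∀ a n f → (∀ i → a ≤ i → i < a + n → f i ≡ 0) → sumFrom a n f ≡ 0
sumFrom-≡0 a n f e = trans (sumFrom-cong a n e) (sumMap-≡0 (λ _ → 0) (applyUpTo (a +_) n) (λ _ → refl))

sumFrom-+-length : ∀ a m n f → sumFrom a (m + n) f ≡ sumFrom a m f + sumFrom (a + m) n f
sumFrom-+-length a zero    n f = cong (λ b → sumFrom b n f) (sym (+-identityʳ a))
sumFrom-+-length a (suc m) n f = begin
  sumFrom a (suc m + n) f                                ≡⟨ sumFrom-suc a (m + n) f ⟩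
  f a + sumFrom (suc a) (m + n) f                        ≡⟨ cong (f a +_) (sumFrom-+-length (suc a) m n f) ⟩
  f a + (sumFrom (suc a) m f + sumFrom (suc a + m) n f) ≡⟨ sym (+-assoc (f a) _ _) ⟩
  f a + sumFrom (suc a) m f + sumFrom (suc a + m) n f   ≡⟨ cong₂ _+_ (sym (sumFrom-suc a m f))
                                                             (cong (λ b → sumFrom b n f) (sym (+-suc a m))) ⟩
  sumFrom a (suc m) f + sumFrom (a + suc m) n f          ∎
  where open ≡-Reasoning

sumFrom-restrict : ∀ a n b m (f : ℕ → ℕ) → a ≤ b → b + m ≤ a + n →
  (∀ i → a ≤ i → i < b → f i ≡ 0) → (∀ i → b + m ≤ i → i < a + n → f i ≡ 0) →
  sumFrom a n f ≡ sumFrom b m f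
sumFrom-restrict a n b m f a≤b b+m≤a+n below above = begin
  sumFrom a n f                                            ≡⟨ cong (λ l → sumFrom a l f) (sym n≡) ⟩
  sumFrom a ((b ∸ a) + (m + rest)) f                       ≡⟨ sumFrom-+-length a (b ∸ a) (m + rest) f ⟩
  sumFrom a (b ∸ a) f + sumFrom (a + (b ∸ a)) (m + rest) f ≡⟨ cong₂ _+_ (sumFrom-≡0 a (b ∸ a) f
                                                                (λ i a≤i i< → below i a≤i (subst (i <_) a+[b∸a]≡b i<)))
                                                                (cong (λ c → sumFrom c (m + rest) f) a+[b∸a]≡b) ⟩
  sumFrom b (m + rest) f                                   ≡⟨ sumFrom-+-length b m rest f ⟩
  sumFrom b m f + sumFrom (b + m) rest f                   ≡⟨ cong (sumFrom b m f +_) (sumFrom-≡0 (b + m) rest f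
                                                                (λ i ≤i i< → above i ≤i (subst (i <_) b+m+rest≡a+n i<))) ⟩
  sumFrom b m f + 0                                        ≡⟨ +-identityʳ _ ⟩
  sumFrom b m f                                            ∎
  where
  open ≡-Reasoning
  rest = a + n ∸ (b + m)
  a+[b∸a]≡b : a + (b ∸ a) ≡ b
  a+[b∸a]≡b = m+[n∸m]≡n a≤b
  b+m+rest≡a+n : b + m + rest ≡ a + n
  b+m+rest≡a+n = m+[n∸m]≡n b+m≤a+n
  n≡ : (b ∸ a) + (m + rest) ≡ n
  n≡ = +-cancelˡ-≡ a _ _ (begin
    a + ((b ∸ a) + (m + rest)) ≡⟨ sym (+-assoc a (b ∸ a) _) ⟩
    a + (b ∸ a) + (m + rest)   ≡⟨ cong (_+ (m + rest)) a+[b∸a]≡b ⟩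
    b + (m + rest)             ≡⟨ sym (+-assoc b m rest) ⟩
    b + m + rest               ≡⟨ b+m+rest≡a+n ⟩
    a + n                      ∎)

range-bound : ∀ a b i → i < suc b ∸ a → a + i ≤ b
range-bound a b i i< = ≤-pred (subst (suc (a + i) ≤_) (m+[n∸m]≡n a≤1+b) (+-monoʳ-< a i<))
  where
  a≤1+b : a ≤ suc b
  a≤1+b = <⇒≤ (m∸n≢0⇒n<m (λ e → n≮0 (subst (i <_) e i<)))

∑-cong : ∀ a b (f f′ : ℕ → ℤ) → (∀ i → a ≤ i → i ≤ b → f i ≡ f′ i) →
  ∑[ a ⋯ b ] f ≡ ∑[ a ⋯ b ] f′
∑-cong a b f f′ e = go (suc b ∸ a) (a +_) (λ i i< → e (a + i) (m≤m+n a i) (range-bound a b i i<))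
  where
  go : ∀ n (g : ℕ → ℕ) → (∀ i → i < n → f (g i) ≡ f′ (g i)) →
    foldr ℤ._+_ (ℤ.+ 0) (map f (applyUpTo g n)) ≡ foldr ℤ._+_ (ℤ.+ 0) (map f′ (applyUpTo g n))
  go zero    g e = refl
  go (suc n) g e = cong₂ ℤ._+_ (e 0 z<s) (go n (g ∘ suc) (λ i i< → e (suc i) (s<s i<)))

∑≡sumFrom : ∀ a b (f : ℕ → ℤ) (g : ℕ → ℕ) → (∀ i → a ≤ i → i ≤ b → f i ≡ ℤ.+ g i) →
  ∑[ a ⋯ b ] f ≡ ℤ.+ sumFrom a (suc b ∸ a) g
∑≡sumFrom a b f g e = trans (∑-cong a b f (λ i → ℤ.+ g i) e) (go (applyUpTo (a +_) (suc b ∸ a)))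
  where
  go : ∀ is → foldr ℤ._+_ (ℤ.+ 0) (map (λ i → ℤ.+ g i) is) ≡ ℤ.+ sumMap g is
  go []       = refl
  go (i ∷ is) = trans (cong (ℤ._+_ (ℤ.+ g i)) (go is)) (sym (ℤ.pos-+ (g i) (sumMap g is)))

+[m+n]-+n≡+m : ∀ m n → ℤ.+ (m + n) ℤ.- ℤ.+ n ≡ ℤ.+ m
+[m+n]-+n≡+m m n = begin
  ℤ.+ (m + n) ℤ.- ℤ.+ n ≡⟨ ℤ.m-n≡m⊖n (m + n) n ⟩
  (m + n) ℤ.⊖ n         ≡⟨ ℤ.⊖-≥ (m≤n+m n m) ⟩
  ℤ.+ (m + n ∸ n)       ≡⟨ cong ℤ.+_ (m+n∸n≡m m n) ⟩
  ℤ.+ m                 ∎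
  where open ≡-Reasoning

m≤n/d⇒m*d≤n : ∀ m n d .{{_ : ℕ.NonZero d}} → m ≤ n / d → m * d ≤ n
m≤n/d⇒m*d≤n m n d m≤n/d = ≤-trans (*-monoˡ-≤ d m≤n/d) (m/n*n≤m n d)

n/d<m⇒n<m*d : ∀ m n d .{{_ : ℕ.NonZero d}} → n / d < m → n < m * d
n/d<m⇒n<m*d m n d n/d<m = begin-strict
  n                 ≡⟨ m≡m%n+[m/n]*n n d ⟩
  n % d + n / d * d <⟨ +-monoˡ-< (n / d * d) (m%n<n n d) ⟩
  d + n / d * d     ≡⟨⟩
  suc (n / d) * d   ≤⟨ *-monoˡ-≤ d n/d<m ⟩
  m * d             ∎
  where open ≤-Reasoning

n/d<n : ∀ n d .{{_ : ℕ.NonZero d}} → 2 ≤ d → 1 ≤ n → n / d < n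
n/d<n (suc n) d 2≤d _ = m/n<m (suc n) d 2≤d

n∸i≡j∸[i+j∸n] : ∀ n i j → i ≤ n → n ≤ i + j → n ∸ i ≡ j ∸ (i + j ∸ n)
n∸i≡j∸[i+j∸n] n i j i≤n n≤i+j = sym (trans (cong (j ∸_) i+j∸n≡j∸[n∸i]) (m∸[m∸n]≡n (m≤n+o⇒m∸n≤o n i n≤i+j)))
  where
  i+j∸n≡j∸[n∸i] : i + j ∸ n ≡ j ∸ (n ∸ i)
  i+j∸n≡j∸[n∸i] = trans (cong (i + j ∸_) (sym (m+[n∸m]≡n i≤n))) ([m+n]∸[m+o]≡n∸o i j (n ∸ i))

≮2t⇒m/2<m : ∀ {t m} → 1 ≤ t → ¬ (m < 2 * t) → m / 2 < m
≮2t⇒m/2<m {t} 1≤t m≮2t = n/d<n _ 2 (s≤s (s≤s z≤n)) (≤-trans (≤-trans 1≤t (m≤m+n t (t + 0))) (≮⇒≥ m≮2t))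

-- Prefixes, suffixes and proper lengths

module _ {a} {A : Set a} where

  take-length-++ : ∀ (xs ys : List A) n → length xs ≡ n → take n (xs ++ ys) ≡ xs
  take-length-++ []       ys .0 refl = refl
  take-length-++ (x ∷ xs) ys ._ refl = cong (x ∷_) (take-length-++ xs ys _ refl)

  drop-length-++ : ∀ (xs ys : List A) n → length xs ≡ n → drop n (xs ++ ys) ≡ ys
  drop-length-++ []       ys .0 refl = refl
  drop-length-++ (x ∷ xs) ys ._ refl = drop-length-++ xs ys _ refl

  take-+-++ : ∀ (xs ys : List A) m n → length xs ≡ m → take (m + n) (xs ++ ys) ≡ xs ++ take n ys
  take-+-++ []       ys .0 n refl = refl
  take-+-++ (x ∷ xs) ys ._ n refl = cong (x ∷_) (take-+-++ xs ys _ n refl)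

  drop-∸-++-++ : ∀ (xs ys zs : List A) {l m} → length xs ≡ l → l + length ys + l ≡ m →
    drop (m ∸ l) (xs ++ ys ++ zs) ≡ zs
  drop-∸-++-++ xs ys zs {l} {m} lx len = begin
    drop (m ∸ l) (xs ++ ys ++ zs)   ≡⟨ cong (drop (m ∸ l)) (sym (++-assoc xs ys zs)) ⟩
    drop (m ∸ l) ((xs ++ ys) ++ zs) ≡⟨ drop-length-++ (xs ++ ys) zs (m ∸ l) (begin
      length (xs ++ ys)             ≡⟨ length-++ xs ⟩
      length xs + length ys         ≡⟨ cong (_+ length ys) lx ⟩
      l + length ys                 ≡⟨ sym (m+n∸n≡m (l + length ys) l) ⟩
      l + length ys + l ∸ l         ≡⟨ cong (_∸ l) len ⟩
      m ∸ l                         ∎) ⟩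
    zs                              ∎
    where open ≡-Reasoning

  take-take-≤ : ∀ {m n} (xs : List A) → m ≤ n → take m (take n xs) ≡ take m xs
  take-take-≤ {m} {n} xs m≤n = trans (take-take m n xs) (cong (λ l → take l xs) (m≤n⇒m⊓n≡m m≤n))

  take-++-≤ : ∀ (xs ys : List A) {m n} → length xs ≡ n → m ≤ n → take m (xs ++ ys) ≡ take m xs
  take-++-≤ xs ys {m} {n} len m≤n =
    trans (sym (take-take-≤ (xs ++ ys) m≤n)) (cong (take m) (take-length-++ xs ys n len))

  length-take-≤ : ∀ {n} (xs : List A) → n ≤ length xs → length (take n xs) ≡ n
  length-take-≤ {n} xs n≤ = trans (length-take n xs) (m≤n⇒m⊓n≡m n≤)

  drop-drop-∸ : ∀ {l m n} (xs : List A) → l ≤ m → m ≤ n → drop (m ∸ l) (drop (n ∸ m) xs) ≡ drop (n ∸ l) xs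
  drop-drop-∸ {l} {m} {n} xs l≤m m≤n = trans (drop-drop (n ∸ m) (m ∸ l) xs) (cong (λ i → drop i xs) (begin
    (n ∸ m) + (m ∸ l) ≡⟨ sym (+-∸-assoc (n ∸ m) l≤m) ⟩
    (n ∸ m) + m ∸ l   ≡⟨ cong (_∸ l) (m∸n+n≡m m≤n) ⟩
    n ∸ l             ∎))
    where open ≡-Reasoning

properLengths⁻ : ∀ {p} {P : ℕ → Set p} {n} → Any P (properLengths n) → ∃ λ l → 1 ≤ l × l < n × P l
properLengths⁻ {n = suc n} any with Any.applyUpTo⁻ suc any
... | i , i<n , p = suc i , s≤s z≤n , s<s i<n , p

properLengths⁺ : ∀ {p} {P : ℕ → Set p} {n l} → 1 ≤ l → l < n → P l → Any P (properLengths n)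
properLengths⁺ {n = suc n} {suc l} _ (s<s l<n) p = Any.applyUpTo⁺ suc p l<n

module FirstOccurrence {q e} {Q : ℕ → Set q} (Q? : ∀ i → Dec (Q i)) {E : ℕ → Set e} (E? : ∀ i → Dec (E i)) where

  First : ℕ → Set q
  First i = Q i × (∀ j → 1 ≤ j → j < i → ¬ Q j)

  χ-any≡sumFrom-χ : ∀ m →
    (∀ i → 1 ≤ i → i ≤ m → E i → First i) → (∀ i → 1 ≤ i → i ≤ m → First i → E i) →
    χ (any? Q? (applyUpTo suc m)) ≡ sumFrom 1 m (λ i → χ (E? i))
  χ-any≡sumFrom-χ zero    to fro = refl
  χ-any≡sumFrom-χ (suc m) to fro = begin
    χ (any? Q? (applyUpTo suc (suc m)))               ≡⟨ χ-any-snoc ⟩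
    χ (any? Q? (applyUpTo suc m)) + χ (E? (suc m))    ≡⟨ cong (_+ χ (E? (suc m))) (χ-any≡sumFrom-χ m
                                                           (λ i 1≤i i≤m → to i 1≤i (m≤n⇒m≤1+n i≤m))
                                                           (λ i 1≤i i≤m → fro i 1≤i (m≤n⇒m≤1+n i≤m))) ⟩
    sumFrom 1 m (λ i → χ (E? i)) + χ (E? (suc m))     ≡⟨ sym (sumFrom-snoc 1 m _) ⟩
    sumFrom 1 (suc m) (λ i → χ (E? i))                ∎
    where
    open ≡-Reasoning
    Qs = applyUpTo suc m
    Qs∷ʳ : Any Q (Qs ++ [ suc m ]) → Any Q (applyUpTo suc (suc m))
    Qs∷ʳ = subst (Any Q) (applyUpTo-∷ʳ suc m)
    χ-any-snoc : χ (any? Q? (applyUpTo suc (suc m))) ≡ χ (any? Q? Qs) + χ (E? (suc m))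
    χ-any-snoc with any? Q? Qs
    ... | yes any = trans (χ-yes (Qs∷ʳ (Any.++⁺ˡ any)) _) (cong suc (sym (χ-no not-first (E? (suc m)))))
      where
      not-first : ¬ E (suc m)
      not-first e with properLengths⁻ {n = suc m} any
      ... | j , 1≤j , j<1+m , q = proj₂ (to (suc m) (s≤s z≤n) ≤-refl e) j 1≤j j<1+m q
    ... | no none = χ-cong
      (λ any → fro (suc m) (s≤s z≤n) ≤-refl
        (last any , λ j 1≤j j<1+m q → none (properLengths⁺ {n = suc m} 1≤j j<1+m q)))
      (λ e → Qs∷ʳ (Any.++⁺ʳ Qs (here (proj₁ (to (suc m) (s≤s z≤n) ≤-refl e)))))
      (any? Q? (applyUpTo suc (suc m))) (E? (suc m))
      where
      last : Any Q (applyUpTo suc (suc m)) → Q (suc m)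
      last any with Any.++⁻ Qs (subst (Any Q) (sym (applyUpTo-∷ʳ suc m)) any)
      ... | inj₁ any′     = ⊥-elim (none any′)
      ... | inj₂ (here q) = q

module _ (k : ℕ) where

  Σw : ℕ → (Word k → ℕ) → ℕ
  Σw n f = sumMap f (words k n)

  Σw-suc : ∀ n f → Σw (suc n) f ≡ sumMap (λ a → Σw n (λ w → f (a ∷ w))) (allFin k)
  Σw-suc n f = trans (sumMap-concatMap f _ (allFin k))
    (sumMap-cong (allFin k) (λ a → sumMap-map f (a ∷_) (words k n)))

  Σw-cong : ∀ n {f g : Word k → ℕ} → (∀ w → length w ≡ n → f w ≡ g w) → Σw n f ≡ Σw n g
  Σw-cong zero    e = cong (_+ 0) (e [] refl)
  Σw-cong (suc n) {f} {g} e = trans (Σw-suc n f) (trans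
    (sumMap-cong (allFin k) (λ a → Σw-cong n (λ w len → e (a ∷ w) (cong suc len)))) (sym (Σw-suc n g)))

  Σw-cong₂ : ∀ m n {f g : Word k → Word k → ℕ} → (∀ x y → length x ≡ m → length y ≡ n → f x y ≡ g x y) →
    Σw m (λ x → Σw n (f x)) ≡ Σw m (λ x → Σw n (g x))
  Σw-cong₂ m n e = Σw-cong m (λ x lx → Σw-cong n (λ y ly → e x y lx ly))

  Σw-++ : ∀ m n f → Σw (m + n) f ≡ Σw m (λ x → Σw n (λ y → f (x ++ y)))
  Σw-++ zero    n f = sym (+-identityʳ _)
  Σw-++ (suc m) n f = trans (Σw-suc (m + n) f) (trans
    (sumMap-cong (allFin k) (λ a → Σw-++ m n (λ w → f (a ∷ w)))) (sym (Σw-suc m _)))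

  Σw-split : ∀ m n {l} → m + n ≡ l → ∀ f → Σw l f ≡ Σw m (λ x → Σw n (λ y → f (x ++ y)))
  Σw-split m n refl f = Σw-++ m n f

  Σw-const : ∀ n c → Σw n (λ _ → c) ≡ k ^ n * c
  Σw-const zero    c = trans (+-identityʳ c) (sym (+-identityʳ c))
  Σw-const (suc n) c = begin
    Σw (suc n) (λ _ → c)                             ≡⟨ Σw-suc n (λ _ → c) ⟩
    sumMap (λ _ → Σw n (λ _ → c)) (allFin k)         ≡⟨ sumMap-cong (allFin k) (λ _ → Σw-const n c) ⟩
    sumMap (λ _ → k ^ n * c) (allFin k)              ≡⟨ sumMap-const (k ^ n * c) (allFin k) ⟩
    length (allFin k) * (k ^ n * c)                  ≡⟨ cong (_* (k ^ n * c)) (length-tabulate {n = k} id) ⟩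
    k * (k ^ n * c)                                  ≡⟨ sym (*-assoc k (k ^ n) c) ⟩
    k ^ suc n * c                                    ∎
    where open ≡-Reasoning

  Σw-+ : ∀ n f g → Σw n (λ w → f w + g w) ≡ Σw n f + Σw n g
  Σw-+ n f g = sumMap-+ f g (words k n)

  Σw-*ˡ : ∀ n c f → Σw n (λ w → c * f w) ≡ c * Σw n f
  Σw-*ˡ n c f = sumMap-*ˡ c f (words k n)

  Σw-*ʳ : ∀ n c f → Σw n (λ w → f w * c) ≡ Σw n f * c
  Σw-*ʳ n c f = sumMap-*ʳ c f (words k n)

  Σw-* : ∀ m n (f g : Word k → ℕ) → Σw m (λ x → Σw n (λ y → f x * g y)) ≡ Σw m f * Σw n g
  Σw-* m n f g = trans (Σw-cong m (λ x _ → Σw-*ˡ n (f x) g)) (Σw-*ʳ m (Σw n g) f)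

  Σw-comm : ∀ m n (f : Word k → Word k → ℕ) → Σw m (λ x → Σw n (f x)) ≡ Σw n (λ y → Σw m (λ x → f x y))
  Σw-comm m n f = sumMap-comm f (words k m) (words k n)

  Σw-comm₂ : ∀ a b c d (F : Word k → Word k → Word k → Word k → ℕ) →
    Σw a (λ u → Σw b (λ v → Σw c (λ x → Σw d (λ y → F u v x y)))) ≡
    Σw c (λ x → Σw d (λ y → Σw a (λ u → Σw b (λ v → F u v x y))))
  Σw-comm₂ a b c d F =
    trans (Σw-cong a (λ u _ → Σw-comm b c _))
    (trans (Σw-cong a (λ u _ → Σw-cong c (λ x _ → Σw-comm b d _)))
    (trans (Σw-comm a c _)
    (Σw-cong c (λ x _ → Σw-comm a d _))))

  Σ² : ℕ → (Word k → Word k → ℕ) → ℕ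
  Σ² n f = Σw n (λ u → Σw n (f u))

  Σ²-+ : ∀ n f g → Σ² n (λ u v → f u v + g u v) ≡ Σ² n f + Σ² n g
  Σ²-+ n f g = trans (Σw-cong n (λ u _ → Σw-+ n (f u) (g u))) (Σw-+ n _ _)

  Σ²-sumFrom : ∀ n a l (f : ℕ → Word k → Word k → ℕ) →
    Σ² n (λ u v → sumFrom a l (λ i → f i u v)) ≡ sumFrom a l (λ i → Σ² n (f i))
  Σ²-sumFrom n a l f =
    trans (Σw-cong n (λ u _ → sym (sumMap-comm (λ i v → f i u v) (applyUpTo (a +_) l) (words k n))))
          (sym (sumMap-comm (λ i u → Σw n (f i u)) (applyUpTo (a +_) l) (words k n)))

  Σw-≡0 : ∀ n f → (∀ w → length w ≡ n → f w ≡ 0) → Σw n f ≡ 0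
  Σw-≡0 n f e = trans (Σw-cong n e) (sumMap-≡0 (λ _ → 0) (words k n) (λ _ → refl))

  Σw≢0⇒∃ : ∀ n (f : Word k → ℕ) → Σw n f ≢ 0 → ∃ λ w → length w ≡ n × f w ≢ 0
  Σw≢0⇒∃ zero    f ne = [] , refl , λ e → ne (cong (_+ 0) e)
  Σw≢0⇒∃ (suc n) f ne with sumMap≢0⇒∃ _ (allFin k) (λ e → ne (trans (Σw-suc n f) e))
  ... | a , h with Σw≢0⇒∃ n (λ w → f (a ∷ w)) h
  ... | w , lw , h′ = a ∷ w , cong suc lw , h′

  χ-∷-≟ : ∀ (a b : Fin k) (w t : Word k) → χ ((a ∷ w) ≟W (b ∷ t)) ≡ χ (a Fin.≟ b) * χ (w ≟W t)
  χ-∷-≟ a b w t =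
    trans (χ-cong ∷-injective (λ (a≡b , w≡t) → cong₂ _∷_ a≡b w≡t) _ _) (χ-× (a Fin.≟ b) (w ≟W t))

  Σw-χ≟ : ∀ n t → length t ≡ n → Σw n (λ w → χ (w ≟W t)) ≡ 1
  Σw-χ≟ zero    []      len = refl
  Σw-χ≟ (suc n) (b ∷ t) len = trans (Σw-suc n _) (trans (sumMap-cong (allFin k) (λ a → begin
      Σw n (λ w → χ ((a ∷ w) ≟W (b ∷ t)))           ≡⟨ Σw-cong n (λ w _ → χ-∷-≟ a b w t) ⟩
      Σw n (λ w → χ (a Fin.≟ b) * χ (w ≟W t))       ≡⟨ Σw-*ˡ n (χ (a Fin.≟ b)) _ ⟩
      χ (a Fin.≟ b) * Σw n (λ w → χ (w ≟W t))       ≡⟨ cong (χ (a Fin.≟ b) *_) (Σw-χ≟ n t (suc-injective len)) ⟩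
      χ (a Fin.≟ b) * 1                             ≡⟨ *-identityʳ _ ⟩
      χ (a Fin.≟ b)                                 ∎))
    (sumMap-allFin-χ≟ k b))
    where open ≡-Reasoning

  Σw-χ≟′ : ∀ n t → length t ≡ n → Σw n (λ w → χ (t ≟W w)) ≡ 1
  Σw-χ≟′ n t len = trans (Σw-cong n (λ w _ → χ-cong sym sym (t ≟W w) (w ≟W t))) (Σw-χ≟ n t len)

  Σw-singleton : ∀ n t → length t ≡ n → (f : Word k → ℕ) {P : Word k → Set} (P? : ∀ w → Dec (P w)) →
    (∀ w → P w → w ≡ t) → (∀ w → w ≡ t → P w) → Σw n (λ w → χ (P? w) * f w) ≡ f t
  Σw-singleton n t len f P? to fro = begin
    Σw n (λ w → χ (P? w) * f w)  ≡⟨ Σw-cong n (λ w _ → pointwise w) ⟩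
    Σw n (λ w → χ (w ≟W t) * f t) ≡⟨ Σw-*ʳ n (f t) _ ⟩
    Σw n (λ w → χ (w ≟W t)) * f t ≡⟨ cong (_* f t) (Σw-χ≟ n t len) ⟩
    1 * f t                       ≡⟨ *-identityˡ (f t) ⟩
    f t                           ∎
    where
    open ≡-Reasoning
    pointwise : ∀ w → χ (P? w) * f w ≡ χ (w ≟W t) * f t
    pointwise w with P? w | w ≟W t
    ... | yes p  | yes refl = refl
    ... | yes p  | no w≢t   = ⊥-elim (w≢t (to w p))
    ... | no ¬p  | yes w≡t  = ⊥-elim (¬p (fro w w≡t))
    ... | no _   | no _     = refl

  χ≟≡Σw : ∀ n (x y : Word k) → length x ≡ n → χ (x ≟W y) ≡ Σw n (λ d → χ (x ≟W d) * χ (y ≟W d))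
  χ≟≡Σw n x y lx = sym (trans
    (Σw-singleton n x lx (λ d → χ (y ≟W d)) (λ d → x ≟W d) (λ _ → sym) (λ _ → sym))
    (χ-cong sym sym (y ≟W x) (x ≟W y)))

  -- Borders and shortest borders

  -- For |u| = n, a right border of (u , v) of length l; BorderAt n v u l is a left border.
  BorderAt : ℕ → Word k → Word k → ℕ → Set
  BorderAt n u v l = take l v ≡ drop (n ∸ l) u

  borderAt? : ∀ n u v l → Dec (BorderAt n u v l)
  borderAt? n u v l = take l v ≟W drop (n ∸ l) u

  HasRightBorder-≡ : ∀ {n u v} → length u ≡ n → length v ≡ n →
    HasRightBorder (u , v) ≡ Any (BorderAt n u v) (properLengths n)
  HasRightBorder-≡ {u = u} {v} refl lv =
    cong (λ m → Any (PreSuf v u) (properLengths m)) (trans (cong (length u ⊓_) lv) (⊓-idem (length u)))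

  HasLeftBorder-≡ : ∀ {n u v} → length u ≡ n → length v ≡ n →
    HasLeftBorder (u , v) ≡ Any (BorderAt n v u) (properLengths n)
  HasLeftBorder-≡ {u = u} {v} lu refl =
    cong (λ m → Any (PreSuf u v) (properLengths m)) (trans (cong (_⊓ length v) lu) (⊓-idem (length v)))

  Bordered-≡ : ∀ {n w} → length w ≡ n → Bordered w ≡ Any (BorderAt n w w) (properLengths n)
  Bordered-≡ refl = refl

  HasRightBorder≡HasLeftBorder-swap : (u v : Word k) → HasRightBorder (u , v) ≡ HasLeftBorder (v , u)
  HasRightBorder≡HasLeftBorder-swap u v =
    cong (λ m → Any (PreSuf v u) (properLengths m)) (⊓-comm (length u) (length v))

  HasRightBorder-diag : (w : Word k) → HasRightBorder (w , w) ≡ Bordered w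
  HasRightBorder-diag w = cong (λ m → Any (PreSuf w w) (properLengths m)) (⊓-idem (length w))

  unbordered? : (w : Word k) → Dec (Unbordered w)
  unbordered? w = ¬? (bordered? w)

  χᵤ : Word k → ℕ
  χᵤ w = χ (unbordered? w)

  ShortestBorderAt : ℕ → Word k → Word k → ℕ → Set
  ShortestBorderAt n u v i = BorderAt n u v i × Unbordered (take i v)

  shortestBorderAt? : ∀ n u v i → Dec (ShortestBorderAt n u v i)
  shortestBorderAt? n u v i = borderAt? n u v i ×-dec unbordered? (take i v)

  -- The borders of a border of (u , v) of length i are exactly the shorter borders of (u , v),
  -- so a border is the shortest one iff it is unbordered.
  χ-any-borderAt≡sumFrom : ∀ {n u v} → length v ≡ n →
    χ (any? (borderAt? n u v) (properLengths n)) ≡ sumFrom 1 (n ∸ 1) (λ i → χ (shortestBorderAt? n u v i))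
  χ-any-borderAt≡sumFrom {n} {u} {v} lv = χ-any≡sumFrom-χ (n ∸ 1) first-if-shortest shortest-if-first
    where
    open FirstOccurrence (borderAt? n u v) (shortestBorderAt? n u v)
    length-prefix : ∀ {i} → i ≤ n ∸ 1 → length (take i v) ≡ i
    length-prefix i≤ = length-take-≤ v (subst (_ ≤_) (sym lv) (≤-trans i≤ (m∸n≤m n 1)))
    border-of-border : ∀ {i j} → i ≤ n ∸ 1 → j < i → BorderAt n u v i →
      BorderAt i (take i v) (take i v) j ≡ BorderAt n u v j
    border-of-border {i} {j} i≤ j<i b = cong₂ _≡_ (take-take-≤ v (<⇒≤ j<i))
      (trans (cong (drop (i ∸ j)) b) (drop-drop-∸ u (<⇒≤ j<i) (≤-trans i≤ (m∸n≤m n 1))))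
    first-if-shortest : ∀ i → 1 ≤ i → i ≤ n ∸ 1 → ShortestBorderAt n u v i → First i
    first-if-shortest i _ i≤ (b , unb) = b , λ j 1≤j j<i bj → unb
      (subst id (sym (Bordered-≡ (length-prefix i≤)))
        (properLengths⁺ 1≤j j<i (subst id (sym (border-of-border i≤ j<i b)) bj)))
    shortest-if-first : ∀ i → 1 ≤ i → i ≤ n ∸ 1 → First i → ShortestBorderAt n u v i
    shortest-if-first i _ i≤ (b , none) = b , λ bord →
      let (j , 1≤j , j<i , bj) = properLengths⁻ (subst id (Bordered-≡ (length-prefix i≤)) bord)
      in none j 1≤j j<i (subst id (border-of-border i≤ j<i b) bj)

  χ-hasRightBorder : ∀ {n u v} → length u ≡ n → length v ≡ n →
    χ (hasRB? (u , v)) ≡ sumFrom 1 (n ∸ 1) (λ i → χ (shortestBorderAt? n u v i))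
  χ-hasRightBorder lu lv = trans (χ-≡ (HasRightBorder-≡ lu lv) _ _) (χ-any-borderAt≡sumFrom lv)

  χ-hasLeftBorder : ∀ {n u v} → length u ≡ n → length v ≡ n →
    χ (hasLB? (u , v)) ≡ sumFrom 1 (n ∸ 1) (λ i → χ (shortestBorderAt? n v u i))
  χ-hasLeftBorder lu lv = trans (χ-≡ (HasLeftBorder-≡ lu lv) _ _) (χ-any-borderAt≡sumFrom lu)

  χ-bordered : ∀ {n w} → length w ≡ n →
    χ (bordered? w) ≡ sumFrom 1 (n ∸ 1) (λ i → χ (shortestBorderAt? n w w i))
  χ-bordered lw = trans (χ-≡ (Bordered-≡ lw) _ _) (χ-any-borderAt≡sumFrom lw)

  -- Pairs counted by the lengths of their shortest borders

  Σw-χ-suffix : ∀ n i (x : Word k) → length x ≡ i → i ≤ n →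
    Σw n (λ u → χ (x ≟W drop (n ∸ i) u)) ≡ k ^ (n ∸ i)
  Σw-χ-suffix n i x lx i≤n = begin
    Σw n (λ u → χ (x ≟W drop (n ∸ i) u))                     ≡⟨ Σw-split (n ∸ i) i (m∸n+n≡m i≤n) _ ⟩
    Σw (n ∸ i) (λ a → Σw i (λ b → χ (x ≟W drop (n ∸ i) (a ++ b))))
      ≡⟨ Σw-cong (n ∸ i) (λ a la → Σw-cong i (λ b _ → cong (λ w → χ (x ≟W w)) (drop-length-++ a b (n ∸ i) la))) ⟩
    Σw (n ∸ i) (λ a → Σw i (λ b → χ (x ≟W b)))             ≡⟨ Σw-cong (n ∸ i) (λ _ _ → Σw-χ≟′ i x lx) ⟩
    Σw (n ∸ i) (λ _ → 1)                                    ≡⟨ trans (Σw-const (n ∸ i) 1) (*-identityʳ _) ⟩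
    k ^ (n ∸ i)                                             ∎
    where open ≡-Reasoning

  Σw-χ-prefix : ∀ n i (x : Word k) → length x ≡ i → i ≤ n →
    Σw n (λ v → χ (x ≟W take i v)) ≡ k ^ (n ∸ i)
  Σw-χ-prefix n i x lx i≤n = begin
    Σw n (λ v → χ (x ≟W take i v))                          ≡⟨ Σw-split i (n ∸ i) (m+[n∸m]≡n i≤n) _ ⟩
    Σw i (λ a → Σw (n ∸ i) (λ b → χ (x ≟W take i (a ++ b))))
      ≡⟨ Σw-cong i (λ a la → Σw-cong (n ∸ i) (λ b _ → cong (λ w → χ (x ≟W w)) (take-length-++ a b i la))) ⟩
    Σw i (λ a → Σw (n ∸ i) (λ _ → χ (x ≟W a)))             ≡⟨ Σw-cong i (λ a _ → Σw-const (n ∸ i) (χ (x ≟W a))) ⟩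
    Σw i (λ a → k ^ (n ∸ i) * χ (x ≟W a))                  ≡⟨ Σw-*ˡ i (k ^ (n ∸ i)) _ ⟩
    k ^ (n ∸ i) * Σw i (λ a → χ (x ≟W a))                  ≡⟨ cong (k ^ (n ∸ i) *_) (Σw-χ≟′ i x lx) ⟩
    k ^ (n ∸ i) * 1                                         ≡⟨ *-identityʳ _ ⟩
    k ^ (n ∸ i)                                             ∎
    where open ≡-Reasoning

  #suffix-prefix : ℕ → ℕ → ℕ → Word k → Word k → ℕ
  #suffix-prefix n i j x y = Σw n (λ u → χ (x ≟W drop (n ∸ i) u) * χ (y ≟W take j u))

  #suffix-prefix-disjoint : ∀ n i j (x y : Word k) → length x ≡ i → length y ≡ j → i + j ≤ n →
    #suffix-prefix n i j x y ≡ k ^ (n ∸ (i + j))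
  #suffix-prefix-disjoint n i j x y lx ly i+j≤n = begin
    #suffix-prefix n i j x y                      ≡⟨ Σw-split j (m + i) j+[m+i]≡n _ ⟩
    Σw j (λ y′ → Σw (m + i) (λ r → f (y′ ++ r)))  ≡⟨ Σw-cong j (λ y′ _ → Σw-++ m i _) ⟩
    Σw j (λ y′ → Σw m (λ z → Σw i (λ x′ → f (y′ ++ (z ++ x′)))))
      ≡⟨ Σw-cong j (λ y′ ly′ → Σw-cong m (λ z lz → Σw-cong i (λ x′ _ → pointwise y′ z x′ ly′ lz))) ⟩
    Σw j (λ y′ → Σw m (λ z → Σw i (λ x′ → χ (y ≟W y′) * χ (x ≟W x′))))
      ≡⟨ Σw-cong j (λ y′ _ → Σw-cong m (λ z _ → Σw-*ˡ i (χ (y ≟W y′)) _)) ⟩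
    Σw j (λ y′ → Σw m (λ z → χ (y ≟W y′) * Σw i (λ x′ → χ (x ≟W x′))))
      ≡⟨ Σw-cong j (λ y′ _ → Σw-cong m (λ z _ → cong (χ (y ≟W y′) *_) (Σw-χ≟′ i x lx))) ⟩
    Σw j (λ y′ → Σw m (λ z → χ (y ≟W y′) * 1))  ≡⟨ Σw-* j m (λ y′ → χ (y ≟W y′)) (λ _ → 1) ⟩
    Σw j (λ y′ → χ (y ≟W y′)) * Σw m (λ _ → 1)  ≡⟨ cong₂ _*_ (Σw-χ≟′ j y ly) (Σw-const m 1) ⟩
    1 * (k ^ m * 1)                              ≡⟨ trans (*-identityˡ _) (*-identityʳ _) ⟩
    k ^ m                                        ∎
    where
    open ≡-Reasoning
    m = n ∸ (i + j)
    f : Word k → ℕ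
    f u = χ (x ≟W drop (n ∸ i) u) * χ (y ≟W take j u)
    m+[i+j]≡n : m + (i + j) ≡ n
    m+[i+j]≡n = m∸n+n≡m i+j≤n
    j+[m+i]≡n : j + (m + i) ≡ n
    j+[m+i]≡n = trans (rearrange j m i) m+[i+j]≡n
      where
      rearrange : ∀ a b c → a + (b + c) ≡ b + (c + a)
      rearrange = solve-∀
    j+m≡n∸i : j + m ≡ n ∸ i
    j+m≡n∸i = trans (sym (m+n∸n≡m (j + m) i)) (cong (_∸ i) (trans (+-assoc j m i) j+[m+i]≡n))
    pointwise : ∀ y′ z x′ → length y′ ≡ j → length z ≡ m →
      f (y′ ++ (z ++ x′)) ≡ χ (y ≟W y′) * χ (x ≟W x′)
    pointwise y′ z x′ ly′ lz = trans (cong₂ (λ a b → χ (x ≟W a) * χ (y ≟W b))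
        (trans (cong (drop (n ∸ i)) (sym (++-assoc y′ z x′)))
          (drop-length-++ (y′ ++ z) x′ (n ∸ i) (trans (length-++ y′) (trans (cong₂ _+_ ly′ lz) j+m≡n∸i))))
        (take-length-++ y′ (z ++ x′) j ly′))
      (*-comm (χ (x ≟W x′)) (χ (y ≟W y′)))

  -- When the suffix x and the prefix y overlap in o = i + j - n letters, u is determined by them,
  -- and exists iff they agree on the overlap.
  #suffix-prefix-overlap : ∀ n i j (x y : Word k) → length x ≡ i → length y ≡ j → i ≤ n → j ≤ n → n < i + j →
    #suffix-prefix n i j x y ≡ χ (take (i + j ∸ n) x ≟W drop (n ∸ i) y)
  #suffix-prefix-overlap n i j x y lx ly i≤n j≤n n<i+j = begin
    #suffix-prefix n i j x y                   ≡⟨ Σw-cong n pointwise ⟩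
    Σw n (λ u → χ (u ≟W t) * χ agree?)         ≡⟨ Σw-*ʳ n _ _ ⟩
    Σw n (λ u → χ (u ≟W t)) * χ agree?         ≡⟨ cong (_* χ agree?) (Σw-χ≟ n t lt) ⟩
    1 * χ agree?                               ≡⟨ *-identityˡ _ ⟩
    χ agree?                                   ∎
    where
    open ≡-Reasoning
    a = n ∸ i
    o = i + j ∸ n
    agree? = take o x ≟W drop a y
    a≤j : a ≤ j
    a≤j = m≤n+o⇒m∸n≤o n i (<⇒≤ n<i+j)
    a+o≡j : a + o ≡ j
    a+o≡j = begin
      (n ∸ i) + (i + j ∸ n) ≡⟨ sym (+-∸-assoc (n ∸ i) (<⇒≤ n<i+j)) ⟩
      (n ∸ i) + (i + j) ∸ n ≡⟨ cong (_∸ n) (sym (+-assoc (n ∸ i) i j)) ⟩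
      (n ∸ i) + i + j ∸ n   ≡⟨ cong (λ m → m + j ∸ n) (m∸n+n≡m i≤n) ⟩
      n + j ∸ n             ≡⟨ m+n∸m≡n n j ⟩
      j                     ∎
    t = take a y ++ x
    la : length (take a y) ≡ a
    la = length-take-≤ y (subst (a ≤_) (sym ly) a≤j)
    lt : length t ≡ n
    lt = trans (length-++ (take a y)) (trans (cong₂ _+_ la lx) (m∸n+n≡m i≤n))
    pointwise : ∀ u → length u ≡ n → χ (x ≟W drop a u) * χ (y ≟W take j u) ≡ χ (u ≟W t) * χ agree?
    pointwise u lu = χ-×-cong (x ≟W drop a u) (y ≟W take j u) (u ≟W t) agree? to fro
      where
      to : x ≡ drop a u → y ≡ take j u → (u ≡ t) × (take o x ≡ drop a y)
      to refl refl = sym (trans (cong (_++ drop a u) (take-take-≤ u a≤j)) (take++drop≡id a u))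
                   , trans (take-drop o a u) (cong (λ m → drop a (take m u)) a+o≡j)
      fro : u ≡ t → take o x ≡ drop a y → (x ≡ drop a u) × (y ≡ take j u)
      fro refl agree = sym (drop-length-++ (take a y) x a la)
                     , sym (begin
                         take j t                 ≡⟨ cong (λ m → take m t) (sym a+o≡j) ⟩
                         take (a + o) t           ≡⟨ take-+-++ (take a y) x a o la ⟩
                         take a y ++ take o x     ≡⟨ cong (take a y ++_) agree ⟩
                         take a y ++ drop a y     ≡⟨ take++drop≡id a y ⟩
                         y                        ∎)

  χ-shortestBorderAt : ∀ n i (u v : Word k) → length v ≡ n → i ≤ n →
    χ (shortestBorderAt? n u v i) ≡ Σw i (λ x → χ (x ≟W take i v) * (χ (x ≟W drop (n ∸ i) u) * χᵤ x))
  χ-shortestBorderAt n i u v lv i≤n = sym (trans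
    (Σw-singleton i (take i v) (length-take-≤ v (subst (i ≤_) (sym lv) i≤n))
      (λ x → χ (x ≟W drop (n ∸ i) u) * χᵤ x) (λ x → x ≟W take i v) (λ _ → id) (λ _ → id))
    (sym (χ-× (borderAt? n u v i) (unbordered? (take i v)))))

  k^m*k^m≡k^[2m] : ∀ m → k ^ m * k ^ m ≡ k ^ (2 * m)
  k^m*k^m≡k^[2m] m = trans (sym (^-distribˡ-+-* k m m)) (cong (k ^_) (cong (m +_) (sym (+-identityʳ m))))

  #shortestRightBorder : ∀ n i → i ≤ n →
    Σ² n (λ u v → χ (shortestBorderAt? n u v i)) ≡ k ^ (2 * n ∸ 2 * i) * Σw i χᵤ
  #shortestRightBorder n i i≤n = begin
    Σ² n (λ u v → χ (shortestBorderAt? n u v i))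
      ≡⟨ Σw-cong₂ n n (λ u v _ lv → χ-shortestBorderAt n i u v lv i≤n) ⟩
    Σ² n (λ u v → Σw i (λ x → χ (x ≟W take i v) * F u x))
      ≡⟨ trans (Σw-cong n (λ u _ → Σw-comm n i _)) (Σw-comm n i _) ⟩
    Σw i (λ x → Σw n (λ u → Σw n (λ v → χ (x ≟W take i v) * F u x)))
      ≡⟨ Σw-cong i (λ x lx → Σw-cong n (λ u _ →
           trans (Σw-*ʳ n (F u x) _) (cong (_* F u x) (Σw-χ-prefix n i x lx i≤n)))) ⟩
    Σw i (λ x → Σw n (λ u → k ^ (n ∸ i) * F u x))
      ≡⟨ Σw-cong i (λ x lx → trans (Σw-*ˡ n (k ^ (n ∸ i)) _) (cong (k ^ (n ∸ i) *_)
           (trans (Σw-*ʳ n (χᵤ x) _) (cong (_* χᵤ x) (Σw-χ-suffix n i x lx i≤n))))) ⟩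
    Σw i (λ x → k ^ (n ∸ i) * (k ^ (n ∸ i) * χᵤ x))
      ≡⟨ Σw-cong i (λ x _ → sym (*-assoc (k ^ (n ∸ i)) _ _)) ⟩
    Σw i (λ x → k ^ (n ∸ i) * k ^ (n ∸ i) * χᵤ x)
      ≡⟨ Σw-*ˡ i (k ^ (n ∸ i) * k ^ (n ∸ i)) χᵤ ⟩
    k ^ (n ∸ i) * k ^ (n ∸ i) * Σw i χᵤ
      ≡⟨ cong (_* Σw i χᵤ) (trans (k^m*k^m≡k^[2m] (n ∸ i)) (cong (k ^_) (*-distribˡ-∸ 2 n i))) ⟩
    k ^ (2 * n ∸ 2 * i) * Σw i χᵤ ∎
    where
    open ≡-Reasoning
    F : Word k → Word k → ℕ
    F u x = χ (x ≟W drop (n ∸ i) u) * χᵤ x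

  #shortestBorders : ℕ → ℕ → ℕ → ℕ
  #shortestBorders n i j = Σ² n (λ u v → χ (shortestBorderAt? n u v i) * χ (shortestBorderAt? n v u j))

  #shortestBorders-Σw : ∀ n i j → i ≤ n → j ≤ n → #shortestBorders n i j ≡
    Σw i (λ x → Σw j (λ y → (χᵤ x * χᵤ y) * (#suffix-prefix n i j x y * #suffix-prefix n j i y x)))
  #shortestBorders-Σw n i j i≤n j≤n = begin
    #shortestBorders n i j
      ≡⟨ Σw-cong₂ n n (λ u v lu lv → trans
           (cong₂ _*_ (χ-shortestBorderAt n i u v lv i≤n) (χ-shortestBorderAt n j v u lu j≤n))
           (sym (Σw-* i j _ _))) ⟩
    Σ² n (λ u v → Σw i (λ x → Σw j (λ y → F u v x y)))
      ≡⟨ Σw-comm₂ n n i j F ⟩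
    Σw i (λ x → Σw j (λ y → Σ² n (λ u v → F u v x y)))
      ≡⟨ Σw-cong₂ i j (λ x y _ _ → trans
           (Σw-cong₂ n n (λ u v _ _ → regroup (χ (x ≟W take i v)) (χ (x ≟W drop (n ∸ i) u)) (χᵤ x)
                                               (χ (y ≟W take j u)) (χ (y ≟W drop (n ∸ j) v)) (χᵤ y)))
           (trans (Σw-cong n (λ u _ → Σw-*ˡ n (χᵤ x * χᵤ y) _)) (trans (Σw-*ˡ n (χᵤ x * χᵤ y) _)
             (cong ((χᵤ x * χᵤ y) *_) (Σw-* n n (A x y) (B x y)))))) ⟩
    Σw i (λ x → Σw j (λ y → (χᵤ x * χᵤ y) * (#suffix-prefix n i j x y * #suffix-prefix n j i y x))) ∎
    where
    open ≡-Reasoning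
    F : Word k → Word k → Word k → Word k → ℕ
    F u v x y = (χ (x ≟W take i v) * (χ (x ≟W drop (n ∸ i) u) * χᵤ x)) *
                (χ (y ≟W take j u) * (χ (y ≟W drop (n ∸ j) v) * χᵤ y))
    A B : Word k → Word k → Word k → ℕ
    A x y u = χ (x ≟W drop (n ∸ i) u) * χ (y ≟W take j u)
    B x y v = χ (y ≟W drop (n ∸ j) v) * χ (x ≟W take i v)
    regroup : ∀ a b c d e f → (a * (b * c)) * (d * (e * f)) ≡ (c * f) * ((b * d) * (e * a))
    regroup = solve-∀

  #shortestBorders-disjoint : ∀ n i j → i + j ≤ n →
    #shortestBorders n i j ≡ Σw i χᵤ * Σw j χᵤ * k ^ (2 * n ∸ 2 * (i + j))
  #shortestBorders-disjoint n i j i+j≤n = begin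
    #shortestBorders n i j
      ≡⟨ #shortestBorders-Σw n i j (≤-trans (m≤m+n i j) i+j≤n) (≤-trans (m≤n+m j i) i+j≤n) ⟩
    Σw i (λ x → Σw j (λ y → (χᵤ x * χᵤ y) * (#suffix-prefix n i j x y * #suffix-prefix n j i y x)))
      ≡⟨ Σw-cong₂ i j (λ x y lx ly → cong ((χᵤ x * χᵤ y) *_) (cong₂ _*_
           (#suffix-prefix-disjoint n i j x y lx ly i+j≤n)
           (trans (#suffix-prefix-disjoint n j i y x ly lx (subst (_≤ n) (+-comm i j) i+j≤n))
                  (cong (λ l → k ^ (n ∸ l)) (+-comm j i))))) ⟩
    Σw i (λ x → Σw j (λ y → χᵤ x * χᵤ y * K))  ≡⟨ Σw-cong i (λ x _ → Σw-*ʳ j K _) ⟩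
    Σw i (λ x → Σw j (λ y → χᵤ x * χᵤ y) * K)  ≡⟨ Σw-*ʳ i K _ ⟩
    Σw i (λ x → Σw j (λ y → χᵤ x * χᵤ y)) * K  ≡⟨ cong (_* K) (Σw-* i j χᵤ χᵤ) ⟩
    Σw i χᵤ * Σw j χᵤ * K
      ≡⟨ cong (Σw i χᵤ * Σw j χᵤ *_)
           (trans (k^m*k^m≡k^[2m] (n ∸ (i + j))) (cong (k ^_) (*-distribˡ-∸ 2 n (i + j)))) ⟩
    Σw i χᵤ * Σw j χᵤ * k ^ (2 * n ∸ 2 * (i + j)) ∎
    where
    open ≡-Reasoning
    K = k ^ (n ∸ (i + j)) * k ^ (n ∸ (i + j))

  #unbordered : ℕ → ℕ → Word k → Word k → ℕ
  #unbordered o m d g = Σw m (λ x → χ (take o x ≟W d) * (χ (drop (m ∸ o) x ≟W g) * χᵤ x))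

  -- Two overlapping shortest borders x (right) and y (left) meet in words d and g of length o:
  -- x runs from d to g and y from g to d.
  #shortestBorders-overlap : ∀ n i j → i ≤ n → j ≤ n → n < i + j → let o = i + j ∸ n in
    #shortestBorders n i j ≡ Σ² o (λ d g → #unbordered o i d g * #unbordered o j g d)
  #shortestBorders-overlap n i j i≤n j≤n n<i+j = begin
    #shortestBorders n i j ≡⟨ #shortestBorders-Σw n i j i≤n j≤n ⟩
    Σw i (λ x → Σw j (λ y → (χᵤ x * χᵤ y) * (#suffix-prefix n i j x y * #suffix-prefix n j i y x)))
      ≡⟨ Σw-cong₂ i j (λ x y lx ly → cong ((χᵤ x * χᵤ y) *_) (cong₂ _*_
           (#suffix-prefix-overlap n i j x y lx ly i≤n j≤n n<i+j)
           (trans (#suffix-prefix-overlap n j i y x ly lx j≤n i≤n (subst (n <_) (+-comm i j) n<i+j))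
                  (cong (λ l → χ (take (l ∸ n) y ≟W drop (n ∸ j) x)) (+-comm j i))))) ⟩
    Σw i (λ x → Σw j (λ y → (χᵤ x * χᵤ y) * (χ (take o x ≟W drop (n ∸ i) y) * χ (take o y ≟W drop (n ∸ j) x))))
      ≡⟨ Σw-cong₂ i j (λ x y lx ly → trans (sym (*-assoc (χᵤ x * χᵤ y) _ _))
           (cong₂ _*_ (cong ((χᵤ x * χᵤ y) *_) (χ-overlap-d x y lx)) (χ-overlap-g x y ly))) ⟩
    Σw i (λ x → Σw j (λ y → (χᵤ x * χᵤ y) * Σw o (α x y) * Σw o (β x y)))
      ≡⟨ Σw-cong₂ i j (λ x y _ _ → trans (cong (_* Σw o (β x y)) (sym (Σw-*ˡ o (χᵤ x * χᵤ y) (α x y))))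
           (sym (Σw-* o o _ _))) ⟩
    Σw i (λ x → Σw j (λ y → Σ² o (λ d g → (χᵤ x * χᵤ y) * α x y d * β x y g)))
      ≡⟨ Σw-comm₂ i j o o _ ⟩
    Σ² o (λ d g → Σw i (λ x → Σw j (λ y → (χᵤ x * χᵤ y) * α x y d * β x y g)))
      ≡⟨ Σw-cong₂ o o (λ d g _ _ → trans (Σw-cong₂ i j (λ x y _ _ → regroup (χᵤ x) (χᵤ y)
           (χ (take o x ≟W d)) (χ (drop (j ∸ o) y ≟W d)) (χ (take o y ≟W g)) (χ (drop (i ∸ o) x ≟W g))))
           (Σw-* i j _ _)) ⟩
    Σ² o (λ d g → #unbordered o i d g * #unbordered o j g d) ∎
    where
    open ≡-Reasoning
    o = i + j ∸ n
    o≤i : o ≤ i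
    o≤i = ≤-trans (∸-monoˡ-≤ n (+-monoʳ-≤ i j≤n)) (≤-reflexive (m+n∸n≡m i n))
    o≤j : o ≤ j
    o≤j = ≤-trans (∸-monoˡ-≤ n (+-monoˡ-≤ j i≤n)) (≤-reflexive (m+n∸m≡n n j))
    e₁ : n ∸ i ≡ j ∸ o
    e₁ = n∸i≡j∸[i+j∸n] n i j i≤n (<⇒≤ n<i+j)
    e₂ : n ∸ j ≡ i ∸ o
    e₂ = trans (n∸i≡j∸[i+j∸n] n j i j≤n (subst (n ≤_) (+-comm i j) (<⇒≤ n<i+j)))
               (cong (λ l → i ∸ (l ∸ n)) (+-comm j i))
    α β : Word k → Word k → Word k → ℕ
    α x y d = χ (take o x ≟W d) * χ (drop (j ∸ o) y ≟W d)
    β x y g = χ (take o y ≟W g) * χ (drop (i ∸ o) x ≟W g)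
    χ-overlap-d : ∀ x y → length x ≡ i → χ (take o x ≟W drop (n ∸ i) y) ≡ Σw o (α x y)
    χ-overlap-d x y lx = trans (cong (λ l → χ (take o x ≟W drop l y)) e₁)
      (χ≟≡Σw o (take o x) _ (length-take-≤ x (subst (o ≤_) (sym lx) o≤i)))
    χ-overlap-g : ∀ x y → length y ≡ j → χ (take o y ≟W drop (n ∸ j) x) ≡ Σw o (β x y)
    χ-overlap-g x y ly = trans (cong (λ l → χ (take o y ≟W drop l x)) e₂)
      (χ≟≡Σw o (take o y) _ (length-take-≤ y (subst (o ≤_) (sym ly) o≤j)))
    regroup : ∀ a b p q c d → (a * b) * (p * q) * (c * d) ≡ (p * (d * a)) * (c * (q * b))
    regroup = solve-∀

  -- Unbordered words with prescribed prefix and suffix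

  Gfuel-< : ∀ t f m → m < 2 * t → Gfuel k t (suc f) m ≡ ℤ.+ 0
  Gfuel-< t f m m<2t with m <? 2 * t
  ... | yes _    = refl
  ... | no m≮2t = ⊥-elim (m≮2t m<2t)

  Gfuel-≮ : ∀ t f m → ¬ (m < 2 * t) → Gfuel k t (suc f) m ≡
    ℤ.+ (k ^ (m ∸ 2 * t)) ℤ.- ∑[ 2 * t ⋯ m / 2 ] (λ i → Gfuel k t f i ℤ.* ℤ.+ (k ^ (m ∸ 2 * i)))
  Gfuel-≮ t f m m≮2t with m <? 2 * t
  ... | yes m<2t = ⊥-elim (m≮2t m<2t)
  ... | no _     = refl

  -- Fuel beyond m is never consumed: the recursion only descends to indices ≤ m/2 < m.
  Gfuel-irrelevant : ∀ t → 1 ≤ t → ∀ f f′ m → m < f → m < f′ → Gfuel k t f m ≡ Gfuel k t f′ m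
  Gfuel-irrelevant t 1≤t (suc f) (suc f′) m m<1+f m<1+f′ with m <? 2 * t
  ... | yes _    = refl
  ... | no m≮2t = cong (ℤ._-_ (ℤ.+ (k ^ (m ∸ 2 * t)))) (∑-cong (2 * t) (m / 2) _ _ (λ i _ i≤m/2 →
    cong (ℤ._* ℤ.+ (k ^ (m ∸ 2 * i))) (Gfuel-irrelevant t 1≤t f f′ i
      (≤-trans (s≤s i≤m/2) (≤-trans (≮2t⇒m/2<m 1≤t m≮2t) (≤-pred m<1+f)))
      (≤-trans (s≤s i≤m/2) (≤-trans (≮2t⇒m/2<m 1≤t m≮2t) (≤-pred m<1+f′))))))

  G-< : ∀ t m → m < 2 * t → G k t m ≡ ℤ.+ 0
  G-< t m = Gfuel-< t m m

  G-≮ : ∀ t → 1 ≤ t → ∀ m → ¬ (m < 2 * t) →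
    G k t m ≡ ℤ.+ (k ^ (m ∸ 2 * t)) ℤ.- ∑[ 2 * t ⋯ m / 2 ] (λ i → G k t i ℤ.* ℤ.+ (k ^ (m ∸ 2 * i)))
  G-≮ t 1≤t m m≮2t = trans (Gfuel-≮ t m m m≮2t) (cong (ℤ._-_ (ℤ.+ (k ^ (m ∸ 2 * t))))
    (∑-cong (2 * t) (m / 2) _ _ (λ i _ i≤m/2 → cong (ℤ._* ℤ.+ (k ^ (m ∸ 2 * i)))
      (Gfuel-irrelevant t 1≤t m (suc i) i (≤-trans (s≤s i≤m/2) (≮2t⇒m/2<m 1≤t m≮2t)) ≤-refl))))

  -- A border longer than half the word overlaps itself, and the overlap is a border of the border.
  long-border⇒Bordered : ∀ {m ℓ} (x : Word k) → length x ≡ m → ℓ < m → m < ℓ + ℓ →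
    BorderAt m x x ℓ → Bordered (take ℓ x)
  long-border⇒Bordered {m} {ℓ} x lx ℓ<m m<ℓ+ℓ b = subst id (sym (Bordered-≡ (length-take-≤ x ℓ≤)))
    (properLengths⁺ (m<n⇒0<n∸m a<ℓ) (∸-monoʳ-< (m<n⇒0<n∸m ℓ<m) (<⇒≤ a<ℓ)) (begin
      take l (take ℓ x)       ≡⟨ cong (take l) b ⟩
      take l (drop a x)       ≡⟨ take-drop l a x ⟩
      drop a (take (a + l) x) ≡⟨ cong (λ i → drop a (take i x)) (m+[n∸m]≡n (<⇒≤ a<ℓ)) ⟩
      drop a (take ℓ x)       ≡⟨ cong (λ i → drop i (take ℓ x)) (sym (m∸[m∸n]≡n (<⇒≤ a<ℓ))) ⟩
      drop (ℓ ∸ l) (take ℓ x) ∎))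
    where
    open ≡-Reasoning
    a = m ∸ ℓ
    l = ℓ ∸ a
    ℓ≤ : ℓ ≤ length x
    ℓ≤ = subst (ℓ ≤_) (sym lx) (<⇒≤ ℓ<m)
    a<ℓ : a < ℓ
    a<ℓ = +-cancelʳ-< ℓ a ℓ (subst (_< ℓ + ℓ) (sym (m∸n+n≡m (<⇒≤ ℓ<m))) m<ℓ+ℓ)

  -- A word is framed when it has prefix p and suffix s.
  module Framed {o} (1≤o : 1 ≤ o) (p s : Word k) (lp : length p ≡ o) (ls : length s ≡ o) where

    prefix? : ∀ x → Dec (take o x ≡ p)
    prefix? x = take o x ≟W p

    suffix? : ∀ m x → Dec (drop (m ∸ o) x ≡ s)
    suffix? m x = drop (m ∸ o) x ≟W s

    χ-framed-≡0 : ∀ x m {R : Set} (R? : Dec R) → (take o x ≡ p → drop (m ∸ o) x ≡ s → R → ⊥) →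
      χ (prefix? x) * (χ (suffix? m x) * χ R?) ≡ 0
    χ-framed-≡0 x m R? ¬R with prefix? x | suffix? m x | R?
    ... | yes a | yes b | yes c = ⊥-elim (¬R a b c)
    ... | yes _ | yes _ | no _  = refl
    ... | yes _ | no _  | _     = refl
    ... | no _  | _     | _     = refl

    border-from-frame : ∀ x {m l} → length x ≡ m → 1 ≤ l → l < m → BorderAt m x x l → Bordered x
    border-from-frame x lx 1≤l l<m b = subst id (sym (Bordered-≡ lx)) (properLengths⁺ 1≤l l<m b)

    #unbordered≡0 : ∀ m → o < m → p ≡ s ⊎ HasLeftBorder (p , s) → #unbordered o m p s ≡ 0
    #unbordered≡0 m o<m p≡s⊎lb = Σw-≡0 m _ (λ x lx → χ-framed-≡0 x m (unbordered? x)
      (λ pre suf unb → unb (bordered x lx pre suf p≡s⊎lb)))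
      where
      bordered : ∀ x → length x ≡ m → take o x ≡ p → drop (m ∸ o) x ≡ s →
        p ≡ s ⊎ HasLeftBorder (p , s) → Bordered x
      bordered x lx pre suf (inj₁ refl) = border-from-frame x lx 1≤o o<m (trans pre (sym suf))
      bordered x lx pre suf (inj₂ lb) with properLengths⁻ (subst id (HasLeftBorder-≡ lp ls) lb)
      ... | l , 1≤l , l<o , b = border-from-frame x lx 1≤l (<-trans l<o o<m) (begin
        take l x                       ≡⟨ sym (take-take-≤ x (<⇒≤ l<o)) ⟩
        take l (take o x)              ≡⟨ cong (take l) pre ⟩
        take l p                       ≡⟨ b ⟩
        drop (o ∸ l) s                 ≡⟨ cong (drop (o ∸ l)) (sym suf) ⟩
        drop (o ∸ l) (drop (m ∸ o) x)  ≡⟨ drop-drop-∸ x (<⇒≤ l<o) (<⇒≤ o<m) ⟩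
        drop (m ∸ l) x                 ∎)
        where open ≡-Reasoning

    framed-overlap⇒HasRightBorder : ∀ (x : Word k) ℓ → o < ℓ → ℓ < o + o →
      take o x ≡ p → drop (ℓ ∸ o) x ≡ s → HasRightBorder (p , s)
    framed-overlap⇒HasRightBorder x ℓ o<ℓ ℓ<o+o pre suf =
      subst id (sym (HasRightBorder-≡ lp ls)) (properLengths⁺ 1≤l l<o border)
      where
      a = ℓ ∸ o
      l = o ∸ a
      a<o : a < o
      a<o = +-cancelʳ-< o a o (subst (_< o + o) (sym (m∸n+n≡m (<⇒≤ o<ℓ))) ℓ<o+o)
      1≤l : 1 ≤ l
      1≤l = m<n⇒0<n∸m a<o
      l<o : l < o
      l<o = ∸-monoʳ-< (m<n⇒0<n∸m o<ℓ) (<⇒≤ a<o)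
      border : take l s ≡ drop (o ∸ l) p
      border = begin
        take l s                 ≡⟨ cong (take l) (sym suf) ⟩
        take l (drop a x)        ≡⟨ take-drop l a x ⟩
        drop a (take (a + l) x)  ≡⟨ cong (λ i → drop a (take i x)) (m+[n∸m]≡n (<⇒≤ a<o)) ⟩
        drop a (take o x)        ≡⟨ cong (drop a) pre ⟩
        drop a p                 ≡⟨ cong (λ i → drop i p) (sym (m∸[m∸n]≡n (<⇒≤ a<o))) ⟩
        drop (o ∸ l) p           ∎
        where open ≡-Reasoning

    framed-length-o⇒≡ : ∀ (x : Word k) → length x ≡ o → take o x ≡ p → drop (o ∸ o) x ≡ s → p ≡ s
    framed-length-o⇒≡ x lx pre suf = begin
      p              ≡⟨ sym pre ⟩
      take o x       ≡⟨ take-all o x (≤-reflexive lx) ⟩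
      x              ≡⟨ cong (λ i → drop i x) (sym (n∸n≡0 o)) ⟩
      drop (o ∸ o) x ≡⟨ suf ⟩
      s              ∎
      where open ≡-Reasoning

    2*o≡o+o : 2 * o ≡ o + o
    2*o≡o+o = cong (o +_) (+-identityʳ o)

    #framed : ℕ → ℕ
    #framed m = Σw m (λ x → χ (prefix? x) * χ (suffix? m x))

    #framed≡ : ∀ m → o + o ≤ m → #framed m ≡ k ^ (m ∸ 2 * o)
    #framed≡ m o+o≤m = begin
      #framed m                 ≡⟨ Σw-cong m (λ x _ → trans (cong₂ _*_
                                     (χ-cong sym sym (prefix? x) (p ≟W take o x))
                                     (χ-cong sym sym (suffix? m x) (s ≟W drop (m ∸ o) x)))
                                     (*-comm (χ (p ≟W take o x)) _)) ⟩
      #suffix-prefix m o o s p  ≡⟨ #suffix-prefix-disjoint m o o s p ls lp o+o≤m ⟩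
      k ^ (m ∸ (o + o))         ≡⟨ cong (λ l → k ^ (m ∸ l)) (sym 2*o≡o+o) ⟩
      k ^ (m ∸ 2 * o)           ∎
      where open ≡-Reasoning

    #framedBordered : ℕ → ℕ
    #framedBordered m = Σw m (λ x → χ (prefix? x) * (χ (suffix? m x) * χ (bordered? x)))

    #unbordered+#framedBordered≡#framed : ∀ m → #unbordered o m p s + #framedBordered m ≡ #framed m
    #unbordered+#framedBordered≡#framed m = trans (sym (Σw-+ m _ _)) (Σw-cong m (λ x _ → begin
      χ (prefix? x) * (χ (suffix? m x) * χᵤ x) + χ (prefix? x) * (χ (suffix? m x) * χ (bordered? x))
        ≡⟨ sym (*-distribˡ-+ (χ (prefix? x)) _ _) ⟩
      χ (prefix? x) * (χ (suffix? m x) * χᵤ x + χ (suffix? m x) * χ (bordered? x))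
        ≡⟨ cong (χ (prefix? x) *_) (sym (*-distribˡ-+ (χ (suffix? m x)) _ _)) ⟩
      χ (prefix? x) * (χ (suffix? m x) * (χᵤ x + χ (bordered? x)))
        ≡⟨ cong (λ c → χ (prefix? x) * (χ (suffix? m x) * c)) (χ-¬+χ (bordered? x)) ⟩
      χ (prefix? x) * (χ (suffix? m x) * 1)
        ≡⟨ cong (χ (prefix? x) *_) (*-identityʳ _) ⟩
      χ (prefix? x) * χ (suffix? m x) ∎))
      where open ≡-Reasoning

    #framedShortest : ℕ → ℕ → ℕ
    #framedShortest m ℓ = Σw m (λ x → χ (prefix? x) * (χ (suffix? m x) * χ (shortestBorderAt? m x x ℓ)))

    #framedBordered≡sumFrom : ∀ m → #framedBordered m ≡ sumFrom 1 (m ∸ 1) (#framedShortest m)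
    #framedBordered≡sumFrom m = begin
      #framedBordered m
        ≡⟨ Σw-cong m (λ x lx → trans (cong (λ c → χ (prefix? x) * (χ (suffix? m x) * c)) (χ-bordered lx))
             (trans (cong (χ (prefix? x) *_) (sym (sumFrom-*ˡ 1 (m ∸ 1) (χ (suffix? m x)) _)))
                    (sym (sumFrom-*ˡ 1 (m ∸ 1) (χ (prefix? x)) _)))) ⟩
      Σw m (λ x → sumFrom 1 (m ∸ 1) (λ ℓ → χ (prefix? x) * (χ (suffix? m x) * χ (shortestBorderAt? m x x ℓ))))
        ≡⟨ sumMap-comm (λ x ℓ → χ (prefix? x) * (χ (suffix? m x) * χ (shortestBorderAt? m x x ℓ)))
             (words k m) (applyUpTo (1 +_) (m ∸ 1)) ⟩
      sumFrom 1 (m ∸ 1) (#framedShortest m) ∎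
      where open ≡-Reasoning

    #framedShortest-high : ∀ m ℓ → m < ℓ + ℓ → ℓ < m → #framedShortest m ℓ ≡ 0
    #framedShortest-high m ℓ m<ℓ+ℓ ℓ<m = Σw-≡0 m _ (λ x lx → χ-framed-≡0 x m (shortestBorderAt? m x x ℓ)
      (λ _ _ (b , unb) → unb (long-border⇒Bordered x lx ℓ<m m<ℓ+ℓ b)))

    χ-framedShortest-++ : ∀ {m ℓ} (a z c : Word k) → o ≤ ℓ → length a ≡ ℓ → ℓ + length z + ℓ ≡ m →
      χ (prefix? (a ++ z ++ c)) * (χ (suffix? m (a ++ z ++ c)) * χ (shortestBorderAt? m (a ++ z ++ c) (a ++ z ++ c) ℓ))
        ≡ χ (c ≟W a) * (χ (prefix? a) * (χ (suffix? ℓ a) * χᵤ a))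
    χ-framedShortest-++ {m} {ℓ} a z c o≤ℓ la len with c ≟W a
    ... | no c≢a = χ-framed-≡0 (a ++ z ++ c) m _ (λ _ _ (b , _) →
      c≢a (trans (sym (drop-∸-++-++ a z c la len)) (trans (sym b) (take-length-++ a (z ++ c) ℓ la))))
    ... | yes refl = begin
      χ (prefix? x) * (χ (suffix? m x) * χ (shortestBorderAt? m x x ℓ))
        ≡⟨ cong₂ (λ u v → χ (u ≟W p) * (χ (v ≟W s) * χ (shortestBorderAt? m x x ℓ)))
             (take-++-≤ a (z ++ a) la o≤ℓ) (trans (sym (drop-drop-∸ x o≤ℓ ℓ≤m)) (cong (drop (ℓ ∸ o)) dl)) ⟩
      χ (prefix? a) * (χ (suffix? ℓ a) * χ (shortestBorderAt? m x x ℓ))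
        ≡⟨ cong (λ e → χ (prefix? a) * (χ (suffix? ℓ a) * e)) (χ-cong
             (λ (_ , unb) → subst Unbordered tl unb)
             (λ unb → trans tl (sym dl) , subst Unbordered (sym tl) unb) _ (unbordered? a)) ⟩
      F            ≡⟨ sym (+-identityʳ F) ⟩
      1 * F        ∎
      where
      open ≡-Reasoning
      x = a ++ z ++ a
      F = χ (prefix? a) * (χ (suffix? ℓ a) * χᵤ a)
      tl : take ℓ x ≡ a
      tl = take-length-++ a (z ++ a) ℓ la
      dl : drop (m ∸ ℓ) x ≡ a
      dl = drop-∸-++-++ a z a la len
      ℓ≤m : ℓ ≤ m
      ℓ≤m = subst (ℓ ≤_) len (m≤n+m ℓ (ℓ + length z))

    module _ (mu : MutuallyUnbordered (p , s)) (p≢s : p ≢ s) where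

      #unbordered-short : ∀ m → m < o + o → #unbordered o m p s ≡ 0
      #unbordered-short m m<o+o = Σw-≡0 m _ (λ x lx → χ-framed-≡0 x m (unbordered? x)
        (λ pre suf _ → impossible x lx pre suf))
        where
        impossible : ∀ x → length x ≡ m → take o x ≡ p → drop (m ∸ o) x ≡ s → ⊥
        impossible x lx pre suf with <-cmp m o
        ... | tri< m<o _ _ = <-irrefl (sym (begin
              o                 ≡⟨ sym lp ⟩
              length p          ≡⟨ cong length (sym pre) ⟩
              length (take o x) ≡⟨ length-take o x ⟩
              o ⊓ length x      ≡⟨ cong (o ⊓_) lx ⟩
              o ⊓ m             ≡⟨ m≥n⇒m⊓n≡n (<⇒≤ m<o) ⟩
              m                 ∎)) m<o
          where open ≡-Reasoning
        ... | tri≈ _ refl _ = p≢s (framed-length-o⇒≡ x lx pre suf)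
        ... | tri> _ _ o<m  = proj₁ mu (framed-overlap⇒HasRightBorder x m o<m m<o+o pre suf)

      #framedShortest-low : ∀ m ℓ → o + o ≤ m → 1 ≤ ℓ → ℓ < o + o → #framedShortest m ℓ ≡ 0
      #framedShortest-low m ℓ o+o≤m 1≤ℓ ℓ<o+o = Σw-≡0 m _ (λ x lx → χ-framed-≡0 x m (shortestBorderAt? m x x ℓ)
        (λ pre suf (b , _) → impossible x pre suf b))
        where
        o≤m : o ≤ m
        o≤m = ≤-trans (m≤m+n o o) o+o≤m
        impossible : ∀ x → take o x ≡ p → drop (m ∸ o) x ≡ s → take ℓ x ≡ drop (m ∸ ℓ) x → ⊥
        impossible x pre suf b with <-cmp ℓ o
        ... | tri< ℓ<o _ _ = proj₂ mu (subst id (sym (HasLeftBorder-≡ lp ls)) (properLengths⁺ 1≤ℓ ℓ<o (begin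
            take ℓ p                       ≡⟨ cong (take ℓ) (sym pre) ⟩
            take ℓ (take o x)              ≡⟨ take-take-≤ x (<⇒≤ ℓ<o) ⟩
            take ℓ x                       ≡⟨ b ⟩
            drop (m ∸ ℓ) x                 ≡⟨ sym (drop-drop-∸ x (<⇒≤ ℓ<o) o≤m) ⟩
            drop (o ∸ ℓ) (drop (m ∸ o) x)  ≡⟨ cong (drop (o ∸ ℓ)) suf ⟩
            drop (o ∸ ℓ) s                 ∎)))
          where open ≡-Reasoning
        ... | tri≈ _ refl _ = p≢s (trans (sym pre) (trans b suf))
        ... | tri> _ _ o<ℓ  = proj₁ mu (framed-overlap⇒HasRightBorder (take ℓ x) ℓ o<ℓ ℓ<o+o
            (trans (take-take-≤ x (<⇒≤ o<ℓ)) pre)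
            (trans (cong (drop (ℓ ∸ o)) b) (trans (drop-drop-∸ x (<⇒≤ o<ℓ) (≤-trans (<⇒≤ ℓ<o+o) o+o≤m)) suf)))

      #framedShortest-mid : ∀ m ℓ → o + o ≤ ℓ → ℓ + ℓ ≤ m →
        #framedShortest m ℓ ≡ k ^ (m ∸ 2 * ℓ) * #unbordered o ℓ p s
      #framedShortest-mid m ℓ o+o≤ℓ ℓ+ℓ≤m = begin
        #framedShortest m ℓ                                     ≡⟨ Σw-split ℓ (r + ℓ) ℓ+[r+ℓ]≡m f ⟩
        Σw ℓ (λ a → Σw (r + ℓ) (λ y → f (a ++ y)))              ≡⟨ Σw-cong ℓ (λ a _ → Σw-++ r ℓ _) ⟩
        Σw ℓ (λ a → Σw r (λ z → Σw ℓ (λ c → f (a ++ z ++ c))))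
          ≡⟨ Σw-cong ℓ (λ a la → Σw-cong r (λ z lz → Σw-cong ℓ (λ c _ →
               χ-framedShortest-++ a z c o≤ℓ la (trans (cong (λ l → ℓ + l + ℓ) lz) (trans (+-assoc ℓ r ℓ) ℓ+[r+ℓ]≡m))))) ⟩
        Σw ℓ (λ a → Σw r (λ z → Σw ℓ (λ c → χ (c ≟W a) * F a)))
          ≡⟨ Σw-cong ℓ (λ a la → Σw-cong r (λ z _ →
               Σw-singleton ℓ a la (λ _ → F a) (λ c → c ≟W a) (λ _ → id) (λ _ → id))) ⟩
        Σw ℓ (λ a → Σw r (λ z → F a))                           ≡⟨ Σw-cong ℓ (λ a _ → Σw-const r (F a)) ⟩
        Σw ℓ (λ a → k ^ r * F a)                                ≡⟨ Σw-*ˡ ℓ (k ^ r) F ⟩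
        k ^ r * #unbordered o ℓ p s                             ∎
        where
        open ≡-Reasoning
        r = m ∸ 2 * ℓ
        ℓ+[r+ℓ]≡m : ℓ + (r + ℓ) ≡ m
        ℓ+[r+ℓ]≡m = trans (rearrange ℓ r) (trans (cong (λ l → m ∸ l + (ℓ + ℓ)) (cong (ℓ +_) (+-identityʳ ℓ)))
                                                 (m∸n+n≡m ℓ+ℓ≤m))
          where
          rearrange : ∀ a b → a + (b + a) ≡ b + (a + a)
          rearrange = solve-∀
        o≤ℓ : o ≤ ℓ
        o≤ℓ = ≤-trans (m≤m+n o o) o+o≤ℓ
        f : Word k → ℕ
        f x = χ (prefix? x) * (χ (suffix? m x) * χ (shortestBorderAt? m x x ℓ))
        F : Word k → ℕ
        F a = χ (prefix? a) * (χ (suffix? ℓ a) * χᵤ a)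

      -- The shortest border of a bordered framed word of length m has length between 2o and m/2.
      #framedBordered≡ : ∀ m → 2 * o ≤ m →
        #framedBordered m ≡ sumFrom (2 * o) (suc (m / 2) ∸ 2 * o) (λ ℓ → #unbordered o ℓ p s * k ^ (m ∸ 2 * ℓ))
      #framedBordered≡ m 2o≤m = begin
        #framedBordered m                       ≡⟨ #framedBordered≡sumFrom m ⟩
        sumFrom 1 (m ∸ 1) (#framedShortest m)
          ≡⟨ sumFrom-restrict 1 (m ∸ 1) c len (#framedShortest m) 1≤c (subst (c + len ≤_) (sym 1+[m∸1]≡m) c+len≤m)
               (λ i 1≤i i<c → #framedShortest-low m i o+o≤m 1≤i (subst (i <_) 2*o≡o+o i<c))
               (λ i c+len≤i i< → #framedShortest-high m i
                 (subst (m <_) (i*2≡i+i i) (n/d<m⇒n<m*d i m 2 (≤-trans (m≤n+m∸n (suc (m / 2)) c) c+len≤i)))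
                 (subst (i <_) 1+[m∸1]≡m i<)) ⟩
        sumFrom c len (#framedShortest m)
          ≡⟨ sumFrom-cong c len (λ i c≤i i< → trans
               (#framedShortest-mid m i (subst (_≤ i) 2*o≡o+o c≤i) (at-most-half i c≤i i<))
               (*-comm (k ^ (m ∸ 2 * i)) (#unbordered o i p s))) ⟩
        sumFrom c len (λ ℓ → #unbordered o ℓ p s * k ^ (m ∸ 2 * ℓ)) ∎
        where
        open ≡-Reasoning
        c = 2 * o
        len = suc (m / 2) ∸ c
        o+o≤m : o + o ≤ m
        o+o≤m = subst (_≤ m) 2*o≡o+o 2o≤m
        1≤c : 1 ≤ c
        1≤c = ≤-trans 1≤o (m≤m+n o (o + 0))
        1≤m : 1 ≤ m
        1≤m = ≤-trans 1≤c 2o≤m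
        1+[m∸1]≡m : 1 + (m ∸ 1) ≡ m
        1+[m∸1]≡m = m+[n∸m]≡n 1≤m
        i*2≡i+i : ∀ i → i * 2 ≡ i + i
        i*2≡i+i = solve-∀
        c+len≤m : c + len ≤ m
        c+len≤m with ≤-total (suc (m / 2)) c
        ... | inj₁ h = subst (_≤ m) (sym (trans (cong (c +_) (m≤n⇒m∸n≡0 h)) (+-identityʳ c))) 2o≤m
        ... | inj₂ h = subst (_≤ m) (sym (m+[n∸m]≡n h)) (n/d<n m 2 (s≤s (s≤s z≤n)) 1≤m)
        at-most-half : ∀ i → c ≤ i → i < c + len → i + i ≤ m
        at-most-half i c≤i i< with i ≤? m / 2
        ... | yes i≤m/2 = subst (_≤ m) (i*2≡i+i i) (m≤n/d⇒m*d≤n i m 2 i≤m/2)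
        ... | no i≰m/2 = ⊥-elim (<-irrefl refl (≤-trans i< (subst (c + len ≤_) (m+[n∸m]≡n c≤i)
                           (+-monoʳ-≤ c (∸-monoˡ-≤ c (≰⇒> i≰m/2))))))

      #unbordered-rec : ∀ m → 2 * o ≤ m →
        #unbordered o m p s + sumFrom (2 * o) (suc (m / 2) ∸ 2 * o) (λ ℓ → #unbordered o ℓ p s * k ^ (m ∸ 2 * ℓ))
          ≡ k ^ (m ∸ 2 * o)
      #unbordered-rec m 2o≤m = begin
        #unbordered o m p s + sumFrom (2 * o) (suc (m / 2) ∸ 2 * o) (λ ℓ → #unbordered o ℓ p s * k ^ (m ∸ 2 * ℓ))
          ≡⟨ cong (#unbordered o m p s +_) (sym (#framedBordered≡ m 2o≤m)) ⟩
        #unbordered o m p s + #framedBordered m ≡⟨ #unbordered+#framedBordered≡#framed m ⟩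
        #framed m                               ≡⟨ #framed≡ m (subst (_≤ m) 2*o≡o+o 2o≤m) ⟩
        k ^ (m ∸ 2 * o)                         ∎
        where open ≡-Reasoning

      #unbordered≡G : ∀ m → ℤ.+ #unbordered o m p s ≡ G k o m
      #unbordered≡G m = bounded m m ≤-refl
        where
        1≤2o : 1 ≤ 2 * o
        1≤2o = ≤-trans 1≤o (m≤m+n o (o + 0))
        bounded : ∀ b m → m ≤ b → ℤ.+ #unbordered o m p s ≡ G k o m
        bounded b m m≤b with 2 * o ≤? m
        ... | no 2o≰m = trans (cong ℤ.+_ (#unbordered-short m (subst (m <_) 2*o≡o+o (≰⇒> 2o≰m))))
                              (sym (G-< o m (≰⇒> 2o≰m)))
        bounded zero    m m≤0   | yes 2o≤m = ⊥-elim (n≮0 (≤-trans 1≤2o (≤-trans 2o≤m m≤0)))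
        bounded (suc b) m m≤1+b | yes 2o≤m = sym (begin
          G k o m
            ≡⟨ G-≮ o 1≤o m (≤⇒≯ 2o≤m) ⟩
          ℤ.+ (k ^ (m ∸ 2 * o)) ℤ.- ∑[ 2 * o ⋯ m / 2 ] (λ i → G k o i ℤ.* ℤ.+ (k ^ (m ∸ 2 * i)))
            ≡⟨ cong (ℤ._-_ (ℤ.+ (k ^ (m ∸ 2 * o)))) (∑≡sumFrom (2 * o) (m / 2) _ term (λ i _ i≤m/2 → trans
                 (cong (ℤ._* ℤ.+ (k ^ (m ∸ 2 * i))) (sym (bounded b i (≤-pred (≤-trans (s≤s i≤m/2)
                   (≤-trans (n/d<n m 2 (s≤s (s≤s z≤n)) (≤-trans 1≤2o 2o≤m)) m≤1+b))))))
                 (sym (ℤ.pos-* (#unbordered o i p s) (k ^ (m ∸ 2 * i)))))) ⟩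
          ℤ.+ (k ^ (m ∸ 2 * o)) ℤ.- ℤ.+ Σterm
            ≡⟨ cong (λ c → ℤ.+ c ℤ.- ℤ.+ Σterm) (sym (#unbordered-rec m 2o≤m)) ⟩
          ℤ.+ (#unbordered o m p s + Σterm) ℤ.- ℤ.+ Σterm
            ≡⟨ +[m+n]-+n≡+m (#unbordered o m p s) Σterm ⟩
          ℤ.+ #unbordered o m p s ∎)
          where
          open ≡-Reasoning
          term : ℕ → ℕ
          term i = #unbordered o i p s * k ^ (m ∸ 2 * i)
          Σterm = sumFrom (2 * o) (suc (m / 2) ∸ 2 * o) term

  -- The counts M, R and U

  u≡Σw : ∀ m → u k m ≡ Σw m χᵤ
  u≡Σw m = length-filter≡sumMap-χ unbordered? (words k m)

  length-filter-wordPairs : ∀ n {P : Word k × Word k → Set} (P? : ∀ q → Dec (P q)) →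
    length (filter P? (wordPairs k n)) ≡ Σ² n (λ u v → χ (P? (u , v)))
  length-filter-wordPairs n P? = trans (length-filter≡sumMap-χ P? (wordPairs k n))
    (sumMap-cartesianProduct (λ q → χ (P? q)) (words k n) (words k n))

  #leftBordered : ℕ → ℕ
  #leftBordered n = Σ² n (λ u v → χ (¬? (hasRB? (u , v)) ×-dec hasLB? (u , v)))

  #leftBordered≡R : ∀ n → #leftBordered n ≡ R k n
  #leftBordered≡R n = sym (trans (length-filter-wordPairs n _) (trans (Σw-comm n n _) (Σw-cong₂ n n (λ v u _ _ →
    χ-cong (λ (rb , ¬lb) → (λ rb′ → ¬lb (subst id (swap v u) rb′)) , subst id (swap u v) rb)
           (λ (¬rb , lb) → subst id (sym (swap u v)) lb , λ lb′ → ¬rb (subst id (sym (swap v u)) lb′))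
           (hasRB? (u , v) ×-dec ¬? (hasLB? (u , v))) (¬? (hasRB? (v , u)) ×-dec hasLB? (v , u))))))
    where swap = HasRightBorder≡HasLeftBorder-swap

  U+2R+M≡k^[2n] : ∀ n → U k n + 2 * R k n + M k n ≡ k ^ (2 * n)
  U+2R+M≡k^[2n] n = begin
    U k n + 2 * R k n + M k n
      ≡⟨ cong (λ r → U k n + (R k n + (r + 0)) + M k n) (sym (#leftBordered≡R n)) ⟩
    U k n + (R k n + (#leftBordered n + 0)) + M k n
      ≡⟨ regroup (U k n) (R k n) (#leftBordered n) (M k n) ⟩
    U k n + R k n + #leftBordered n + M k n
      ≡⟨ cong₂ _+_ (cong₂ (λ a b → a + b + #leftBordered n) (length-filter-wordPairs n _) (length-filter-wordPairs n _))
                   (length-filter-wordPairs n _) ⟩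
    Σ² n UU + Σ² n RB + Σ² n LB + Σ² n MB
      ≡⟨ sym (trans (Σ²-+ n (λ u v → UU u v + RB u v + LB u v) MB)
           (cong (_+ Σ² n MB) (trans (Σ²-+ n (λ u v → UU u v + RB u v) LB) (cong (_+ Σ² n LB) (Σ²-+ n UU RB))))) ⟩
    Σ² n (λ u v → UU u v + RB u v + LB u v + MB u v)
      ≡⟨ Σw-cong₂ n n (λ u v _ _ → χ-partition (hasRB? (u , v)) (hasLB? (u , v))) ⟩
    Σ² n (λ _ _ → 1)
      ≡⟨ Σw-cong n (λ _ _ → trans (Σw-const n 1) (*-identityʳ _)) ⟩
    Σw n (λ _ → k ^ n)  ≡⟨ Σw-const n (k ^ n) ⟩
    k ^ n * k ^ n       ≡⟨ k^m*k^m≡k^[2m] n ⟩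
    k ^ (2 * n)         ∎
    where
    open ≡-Reasoning
    UU RB LB MB : Word k → Word k → ℕ
    UU u v = χ (¬? (hasRB? (u , v)) ×-dec ¬? (hasLB? (u , v)))
    RB u v = χ (hasRB? (u , v) ×-dec ¬? (hasLB? (u , v)))
    LB u v = χ (¬? (hasRB? (u , v)) ×-dec hasLB? (u , v))
    MB u v = χ (hasRB? (u , v) ×-dec hasLB? (u , v))
    regroup : ∀ a b c d → a + (b + (c + 0)) + d ≡ a + b + c + d
    regroup = solve-∀

  M-1≡0 : M k 1 ≡ 0
  M-1≡0 = trans (length-filter-wordPairs 1 _) (Σw-≡0 1 _ (λ u lu → Σw-≡0 1 _ (λ v lv →
    trans (χ-× (hasRB? (u , v)) (hasLB? (u , v))) (cong (_* χ (hasLB? (u , v))) (χ-hasRightBorder {u = u} {v} lu lv)))))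

  R+M≡ : ∀ n → R k n + M k n ≡ sumFrom 1 (n ∸ 1) (λ i → k ^ (2 * n ∸ 2 * i) * u k i)
  R+M≡ n = begin
    R k n + M k n
      ≡⟨ cong₂ _+_ (length-filter-wordPairs n _) (length-filter-wordPairs n _) ⟩
    Σ² n (λ u v → χ (hasRB? (u , v) ×-dec ¬? (hasLB? (u , v)))) + Σ² n (λ u v → χ (hasRB? (u , v) ×-dec hasLB? (u , v)))
      ≡⟨ sym (Σ²-+ n _ _) ⟩
    Σ² n (λ u v → χ (hasRB? (u , v) ×-dec ¬? (hasLB? (u , v))) + χ (hasRB? (u , v) ×-dec hasLB? (u , v)))
      ≡⟨ Σw-cong₂ n n (λ u v lu lv → trans (χ-×¬+χ-× (hasRB? (u , v)) (hasLB? (u , v))) (χ-hasRightBorder lu lv)) ⟩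
    Σ² n (λ u v → sumFrom 1 (n ∸ 1) (λ i → χ (shortestBorderAt? n u v i)))
      ≡⟨ Σ²-sumFrom n 1 (n ∸ 1) (λ i u v → χ (shortestBorderAt? n u v i)) ⟩
    sumFrom 1 (n ∸ 1) (λ i → Σ² n (λ u v → χ (shortestBorderAt? n u v i)))
      ≡⟨ sumFrom-cong 1 (n ∸ 1) (λ i _ i< → trans (#shortestRightBorder n i (≤-trans (≤-pred i<) (m∸n≤m n 1)))
           (cong (k ^ (2 * n ∸ 2 * i) *_) (sym (u≡Σw i)))) ⟩
    sumFrom 1 (n ∸ 1) (λ i → k ^ (2 * n ∸ 2 * i) * u k i) ∎
    where open ≡-Reasoning

  R-formula : ∀ n → ℤ.+ R k n ≡ ∑[ 1 ⋯ n ∸ 1 ] (λ i → ℤ.+ (k ^ (2 * n ∸ 2 * i) * u k i)) ℤ.- ℤ.+ M k n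
  R-formula n = begin
    ℤ.+ R k n                             ≡⟨ sym (+[m+n]-+n≡+m (R k n) (M k n)) ⟩
    ℤ.+ (R k n + M k n) ℤ.- ℤ.+ M k n    ≡⟨ cong (λ c → ℤ.+ c ℤ.- ℤ.+ M k n) (R+M≡ n) ⟩
    ℤ.+ sumFrom 1 (n ∸ 1) (λ i → k ^ (2 * n ∸ 2 * i) * u k i) ℤ.- ℤ.+ M k n
      ≡⟨ cong (ℤ._- ℤ.+ M k n) (sym (∑≡sumFrom 1 (n ∸ 1) _ _ (λ _ _ _ → refl))) ⟩
    ∑[ 1 ⋯ n ∸ 1 ] (λ i → ℤ.+ (k ^ (2 * n ∸ 2 * i) * u k i)) ℤ.- ℤ.+ M k n ∎
    where open ≡-Reasoning

  M≡sumFrom² : ∀ n → M k n ≡ sumFrom 1 (n ∸ 1) (λ i → sumFrom 1 (n ∸ 1) (λ j → #shortestBorders n i j))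
  M≡sumFrom² n = begin
    M k n ≡⟨ length-filter-wordPairs n _ ⟩
    Σ² n (λ u v → χ (hasRB? (u , v) ×-dec hasLB? (u , v)))
      ≡⟨ Σw-cong₂ n n (λ u v lu lv → begin
           χ (hasRB? (u , v) ×-dec hasLB? (u , v))              ≡⟨ χ-× (hasRB? (u , v)) (hasLB? (u , v)) ⟩
           χ (hasRB? (u , v)) * χ (hasLB? (u , v))
             ≡⟨ cong₂ _*_ (χ-hasRightBorder lu lv) (χ-hasLeftBorder lu lv) ⟩
           sumFrom 1 (n ∸ 1) (σ u v) * sumFrom 1 (n ∸ 1) (σ v u) ≡⟨ sym (sumFrom-*ʳ 1 (n ∸ 1) _ (σ u v)) ⟩
           sumFrom 1 (n ∸ 1) (λ i → σ u v i * sumFrom 1 (n ∸ 1) (σ v u))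
             ≡⟨ sumFrom-cong 1 (n ∸ 1) (λ i _ _ → sym (sumFrom-*ˡ 1 (n ∸ 1) (σ u v i) (σ v u))) ⟩
           sumFrom 1 (n ∸ 1) (λ i → sumFrom 1 (n ∸ 1) (λ j → σ u v i * σ v u j)) ∎) ⟩
    Σ² n (λ u v → sumFrom 1 (n ∸ 1) (λ i → sumFrom 1 (n ∸ 1) (λ j → σ u v i * σ v u j)))
      ≡⟨ Σ²-sumFrom n 1 (n ∸ 1) _ ⟩
    sumFrom 1 (n ∸ 1) (λ i → Σ² n (λ u v → sumFrom 1 (n ∸ 1) (λ j → σ u v i * σ v u j)))
      ≡⟨ sumFrom-cong 1 (n ∸ 1) (λ i _ _ → Σ²-sumFrom n 1 (n ∸ 1) _) ⟩
    sumFrom 1 (n ∸ 1) (λ i → sumFrom 1 (n ∸ 1) (λ j → #shortestBorders n i j)) ∎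
    where
    open ≡-Reasoning
    σ : Word k → Word k → ℕ → ℕ
    σ u v i = χ (shortestBorderAt? n u v i)

  #overlapping : ℕ → ℕ → ℕ → ℕ
  #overlapping n i o = Σ² o (λ d g → #unbordered o i d g * #unbordered o (n ∸ i + o) g d)

  sumFrom-#shortestBorders : ∀ n i → 1 ≤ i → i < n →
    sumFrom 1 (n ∸ 1) (λ j → #shortestBorders n i j) ≡
    sumFrom 1 (n ∸ i) (λ j → u k i * u k j * k ^ (2 * n ∸ 2 * (i + j))) + sumFrom 1 (i ∸ 1) (#overlapping n i)
  sumFrom-#shortestBorders n i 1≤i i<n = begin
    sumFrom 1 (n ∸ 1) (#shortestBorders n i)
      ≡⟨ cong (λ l → sumFrom 1 l (#shortestBorders n i)) (sym [n∸i]+[i∸1]≡n∸1) ⟩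
    sumFrom 1 ((n ∸ i) + (i ∸ 1)) (#shortestBorders n i)
      ≡⟨ sumFrom-+-length 1 (n ∸ i) (i ∸ 1) _ ⟩
    sumFrom 1 (n ∸ i) (#shortestBorders n i) + sumFrom (1 + (n ∸ i)) (i ∸ 1) (#shortestBorders n i)
      ≡⟨ cong₂ _+_ (sumFrom-cong 1 (n ∸ i) (λ j _ j< → disjoint j (i+j≤n j j<)))
           (trans (cong (λ a → sumFrom a (i ∸ 1) (#shortestBorders n i)) (+-comm 1 (n ∸ i)))
                  (sumFrom-shift 1 (n ∸ i) (i ∸ 1) _)) ⟩
    sumFrom 1 (n ∸ i) term + sumFrom 1 (i ∸ 1) (λ o → #shortestBorders n i (n ∸ i + o))
      ≡⟨ cong (sumFrom 1 (n ∸ i) term +_) (sumFrom-cong 1 (i ∸ 1) (λ o 1≤o o< →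
           overlapping o 1≤o (subst (o <_) (m+[n∸m]≡n 1≤i) o<))) ⟩
    sumFrom 1 (n ∸ i) term + sumFrom 1 (i ∸ 1) (#overlapping n i) ∎
    where
    open ≡-Reasoning
    i≤n = <⇒≤ i<n
    term : ℕ → ℕ
    term j = u k i * u k j * k ^ (2 * n ∸ 2 * (i + j))
    [n∸i]+[i∸1]≡n∸1 : (n ∸ i) + (i ∸ 1) ≡ n ∸ 1
    [n∸i]+[i∸1]≡n∸1 = trans (sym (+-∸-assoc (n ∸ i) 1≤i)) (cong (_∸ 1) (m∸n+n≡m i≤n))
    i+j≤n : ∀ j → j < 1 + (n ∸ i) → i + j ≤ n
    i+j≤n j j< = subst (i + j ≤_) (m+[n∸m]≡n i≤n) (+-monoʳ-≤ i (≤-pred j<))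
    disjoint : ∀ j → i + j ≤ n → #shortestBorders n i j ≡ term j
    disjoint j i+j≤n = trans (#shortestBorders-disjoint n i j i+j≤n)
      (cong₂ (λ a b → a * b * k ^ (2 * n ∸ 2 * (i + j))) (sym (u≡Σw i)) (sym (u≡Σw j)))
    overlapping : ∀ o → 1 ≤ o → o < i → #shortestBorders n i (n ∸ i + o) ≡ #overlapping n i o
    overlapping o 1≤o o<i = trans (#shortestBorders-overlap n i j i≤n j≤n n<i+j)
      (cong (λ l → Σ² l (λ d g → #unbordered l i d g * #unbordered l j g d)) i+j∸n≡o)
      where
      j = n ∸ i + o
      j≤n : j ≤ n
      j≤n = subst (j ≤_) (m∸n+n≡m i≤n) (+-monoʳ-≤ (n ∸ i) (<⇒≤ o<i))
      i+j≡n+o : i + j ≡ n + o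
      i+j≡n+o = trans (sym (+-assoc i (n ∸ i) o)) (cong (_+ o) (m+[n∸m]≡n i≤n))
      n<i+j : n < i + j
      n<i+j = subst (n <_) (sym i+j≡n+o) (subst (_≤ n + o) (+-comm n 1) (+-monoʳ-≤ n 1≤o))
      i+j∸n≡o : i + j ∸ n ≡ o
      i+j∸n≡o = trans (cong (_∸ n) i+j≡n+o) (m+n∸m≡n n o)

  MUDistinct : Word k → Word k → Set
  MUDistinct d g = MutuallyUnbordered (d , g) × d ≢ g

  muDistinct? : ∀ d g → Dec (MUDistinct d g)
  muDistinct? d g = (¬? (hasRB? (d , g)) ×-dec ¬? (hasLB? (d , g))) ×-dec ¬? (d ≟W g)

  #muDistinct : ℕ → ℕ
  #muDistinct o = Σ² o (λ d g → χ (muDistinct? d g))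

  U≡#muDistinct+u : ∀ o → U k o ≡ #muDistinct o + u k o
  U≡#muDistinct+u o = begin
    U k o ≡⟨ length-filter-wordPairs o _ ⟩
    Σ² o (λ d g → χ (mu? d g))
      ≡⟨ Σw-cong₂ o o (λ d g _ _ → sym (trans (cong (χ (muDistinct? d g) +_) (sym (diagonal d g)))
           (χ-×¬+χ-× (mu? d g) (d ≟W g)))) ⟩
    Σ² o (λ d g → χ (muDistinct? d g) + χ (g ≟W d) * χᵤ d)
      ≡⟨ Σ²-+ o _ _ ⟩
    #muDistinct o + Σ² o (λ d g → χ (g ≟W d) * χᵤ d)
      ≡⟨ cong (#muDistinct o +_) (Σw-cong o (λ d ld →
           Σw-singleton o d ld (λ _ → χᵤ d) (λ g → g ≟W d) (λ _ → id) (λ _ → id))) ⟩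
    #muDistinct o + Σw o χᵤ ≡⟨ cong (#muDistinct o +_) (sym (u≡Σw o)) ⟩
    #muDistinct o + u k o ∎
    where
    open ≡-Reasoning
    mu? : ∀ d g → Dec (MutuallyUnbordered (d , g))
    mu? d g = ¬? (hasRB? (d , g)) ×-dec ¬? (hasLB? (d , g))
    diagonal : ∀ d g → χ (mu? d g ×-dec (d ≟W g)) ≡ χ (g ≟W d) * χᵤ d
    diagonal d g with d ≟W g
    ... | yes refl = trans (χ-cong (λ ((¬rb , _) , _) bd → ¬rb (subst id (sym (HasRightBorder-diag d)) bd))
                                   (λ unb → ((λ rb → unb (subst id (HasRightBorder-diag d) rb))
                                           , (λ lb → unb (subst id (trans (sym (HasRightBorder≡HasLeftBorder-swap d d))
                                                                          (HasRightBorder-diag d)) lb))) , refl)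
                                   (mu? d d ×-dec yes refl) (unbordered? d))
                      (trans (sym (+-identityʳ (χᵤ d))) (cong (_* χᵤ d) (sym (χ-yes refl (d ≟W d)))))
    ... | no d≢g = trans (χ-no (λ (_ , d≡g) → d≢g d≡g) (mu? d g ×-dec no d≢g))
                         (cong (_* χᵤ d) (sym (χ-no (λ g≡d → d≢g (sym g≡d)) (g ≟W d))))

  ∣G∣ : ℕ → ℕ → ℕ
  ∣G∣ o m = ℤ.∣ G k o m ∣

  MUDistinct-swap : ∀ {d g} → MUDistinct d g → MUDistinct g d
  MUDistinct-swap {d} {g} ((¬rb , ¬lb) , d≢g) =
    ( (λ rb → ¬lb (subst id (HasRightBorder≡HasLeftBorder-swap g d) rb))
    , (λ lb → ¬rb (subst id (sym (HasRightBorder≡HasLeftBorder-swap d g)) lb)))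
    , (λ g≡d → d≢g (sym g≡d))

  G≡+#unbordered : ∀ {o} → 1 ≤ o → ∀ {d g} → length d ≡ o → length g ≡ o → MUDistinct d g →
    ∀ m → G k o m ≡ ℤ.+ #unbordered o m d g
  G≡+#unbordered 1≤o ld lg (mu , d≢g) m = sym (Framed.#unbordered≡G 1≤o _ _ ld lg mu d≢g m)

  #unbordered-product : ∀ {o} i j (d g : Word k) → 1 ≤ o → length d ≡ o → length g ≡ o → o < i → o < j →
    #unbordered o i d g * #unbordered o j g d ≡ χ (muDistinct? d g) * (∣G∣ o i * ∣G∣ o j)
  #unbordered-product {o} i j d g 1≤o ld lg o<i o<j with muDistinct? d g
  ... | yes mud = trans (cong₂ _*_
        (cong ℤ.∣_∣ (sym (G≡+#unbordered 1≤o ld lg mud i)))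
        (cong ℤ.∣_∣ (sym (G≡+#unbordered 1≤o lg ld (MUDistinct-swap mud) j)))) (sym (+-identityʳ _))
  ... | no ¬mud with d ≟W g | hasLB? (d , g) | hasRB? (d , g)
  ...   | yes d≡g | _      | _      =
    cong (_* #unbordered o j g d) (Framed.#unbordered≡0 1≤o d g ld lg i o<i (inj₁ d≡g))
  ...   | no _    | yes lb | _      =
    cong (_* #unbordered o j g d) (Framed.#unbordered≡0 1≤o d g ld lg i o<i (inj₂ lb))
  ...   | no _    | no _   | yes rb = trans
    (cong (#unbordered o i d g *_) (Framed.#unbordered≡0 1≤o g d lg ld j o<j
      (inj₂ (subst id (HasRightBorder≡HasLeftBorder-swap d g) rb))))
    (*-zeroʳ (#unbordered o i d g))
  ...   | no d≢g  | no ¬lb | no ¬rb = ⊥-elim (¬mud ((¬rb , ¬lb) , d≢g))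

  overlapTerm : ℕ → ℕ → ℕ → ℕ
  overlapTerm n o i = #muDistinct o * (∣G∣ o i * ∣G∣ o (n ∸ i + o))

  #overlapping≡overlapTerm : ∀ n o i → 1 ≤ o → o < i → i < n → #overlapping n i o ≡ overlapTerm n o i
  #overlapping≡overlapTerm n o i 1≤o o<i i<n = begin
    #overlapping n i o
      ≡⟨ Σw-cong₂ o o (λ d g ld lg → #unbordered-product i (n ∸ i + o) d g 1≤o ld lg o<i o<n∸i+o) ⟩
    Σ² o (λ d g → χ (muDistinct? d g) * (∣G∣ o i * ∣G∣ o (n ∸ i + o)))
      ≡⟨ trans (Σw-cong o (λ d _ → Σw-*ʳ o _ _)) (Σw-*ʳ o _ _) ⟩
    overlapTerm n o i ∎
    where
    open ≡-Reasoning
    o<n∸i+o : o < n ∸ i + o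
    o<n∸i+o = subst (o <_) (+-comm o (n ∸ i)) (m<m+n o (m<n⇒0<n∸m i<n))

  overlapTerm-≡0ˡ : ∀ n o i → i < 2 * o → overlapTerm n o i ≡ 0
  overlapTerm-≡0ˡ n o i i<2o = begin
    #muDistinct o * (∣G∣ o i * ∣G∣ o (n ∸ i + o))
      ≡⟨ cong (λ c → #muDistinct o * (ℤ.∣ c ∣ * ∣G∣ o (n ∸ i + o))) (G-< o i i<2o) ⟩
    #muDistinct o * 0                             ≡⟨ *-zeroʳ (#muDistinct o) ⟩
    0                                              ∎
    where open ≡-Reasoning

  overlapTerm-≡0ʳ : ∀ n o i → 1 ≤ o → n < i + o → overlapTerm n o i ≡ 0
  overlapTerm-≡0ʳ n o i 1≤o n<i+o = begin
    #muDistinct o * (∣G∣ o i * ∣G∣ o (n ∸ i + o))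
      ≡⟨ cong (λ c → #muDistinct o * (∣G∣ o i * ℤ.∣ c ∣)) (G-< o (n ∸ i + o) n∸i+o<2o) ⟩
    #muDistinct o * (∣G∣ o i * 0) ≡⟨ cong (#muDistinct o *_) (*-zeroʳ (∣G∣ o i)) ⟩
    #muDistinct o * 0             ≡⟨ *-zeroʳ (#muDistinct o) ⟩
    0                              ∎
    where
    open ≡-Reasoning
    n∸i<o : n ∸ i < o
    n∸i<o with i ≤? n
    ... | yes i≤n = +-cancelʳ-< i (n ∸ i) o (subst (_< o + i) (sym (m∸n+n≡m i≤n)) (subst (n <_) (+-comm i o) n<i+o))
    ... | no i≰n  = subst (_< o) (sym (m≤n⇒m∸n≡0 (<⇒≤ (≰⇒> i≰n)))) 1≤o
    n∸i+o<2o : n ∸ i + o < 2 * o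
    n∸i+o<2o = subst (n ∸ i + o <_) (cong (o +_) (sym (+-identityʳ o))) (+-monoˡ-< o n∸i<o)

  o*3≡2*o+o : ∀ o → o * 3 ≡ 2 * o + o
  o*3≡2*o+o = solve-∀

  overlapTerm-≡0-large : ∀ n o i → 1 ≤ o → n / 3 < o → overlapTerm n o i ≡ 0
  overlapTerm-≡0-large n o i 1≤o n/3<o with 2 * o ≤? i
  ... | no 2o≰i  = overlapTerm-≡0ˡ n o i (≰⇒> 2o≰i)
  ... | yes 2o≤i = overlapTerm-≡0ʳ n o i 1≤o
    (≤-trans (n/d<m⇒n<m*d o n 3 n/3<o) (≤-trans (≤-reflexive (o*3≡2*o+o o)) (+-monoˡ-≤ o 2o≤i)))

  sumFrom-overlapTerm-restrict : ∀ n o → 1 ≤ o → o ≤ n / 3 →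
    sumFrom 1 (n ∸ 1) (overlapTerm n o) ≡ sumFrom (2 * o) (suc (n ∸ o) ∸ 2 * o) (overlapTerm n o)
  sumFrom-overlapTerm-restrict n o 1≤o o≤n/3 = sumFrom-restrict 1 (n ∸ 1) (2 * o) (suc (n ∸ o) ∸ 2 * o) _
    (≤-trans 1≤o (m≤m+n o (o + 0)))
    (subst (_≤ 1 + (n ∸ 1)) (sym (m+[n∸m]≡n 2o≤1+[n∸o])) (subst (suc (n ∸ o) ≤_) (sym 1+[n∸1]≡n)
      (∸-monoʳ-< 1≤o o≤n)))
    (λ i _ i<2o → overlapTerm-≡0ˡ n o i i<2o)
    (λ i ≤i _ → overlapTerm-≡0ʳ n o i 1≤o (subst (_< i + o) (m∸n+n≡m o≤n)
      (+-monoˡ-< o (subst (_≤ i) (m+[n∸m]≡n 2o≤1+[n∸o]) ≤i))))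
    where
    2o+o≤n : 2 * o + o ≤ n
    2o+o≤n = subst (_≤ n) (o*3≡2*o+o o) (m≤n/d⇒m*d≤n o n 3 o≤n/3)
    o≤n : o ≤ n
    o≤n = ≤-trans (m≤n+m o (2 * o)) 2o+o≤n
    1≤n : 1 ≤ n
    1≤n = ≤-trans 1≤o o≤n
    1+[n∸1]≡n : 1 + (n ∸ 1) ≡ n
    1+[n∸1]≡n = m+[n∸m]≡n 1≤n
    2o≤1+[n∸o] : 2 * o ≤ suc (n ∸ o)
    2o≤1+[n∸o] = ≤-trans (subst (_≤ n ∸ o) (m+n∸n≡m (2 * o) o) (∸-monoˡ-≤ o 2o+o≤n)) (n≤1+n _)

  -- overlapTerm n o i vanishes unless 2 o ≤ i ≤ n - o, which is possible only for o ≤ n / 3.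
  sumFrom-overlapTerm-reindex : ∀ n → 1 ≤ n →
    sumFrom 1 (n ∸ 1) (λ i → sumFrom 1 (i ∸ 1) (λ o → overlapTerm n o i)) ≡
    sumFrom 1 (n / 3) (λ o → sumFrom (2 * o) (suc (n ∸ o) ∸ 2 * o) (overlapTerm n o))
  sumFrom-overlapTerm-reindex n 1≤n = begin
    sumFrom 1 (n ∸ 1) (λ i → sumFrom 1 (i ∸ 1) (λ o → overlapTerm n o i))
      ≡⟨ sumFrom-cong 1 (n ∸ 1) (λ i 1≤i i< → sym (sumFrom-restrict 1 (n ∸ 1) 1 (i ∸ 1) _ ≤-refl
           (+-monoʳ-≤ 1 (∸-monoˡ-≤ 1 (<⇒≤ (subst (i <_) 1+[n∸1]≡n i<))))
           (λ o 1≤o o<1 → ⊥-elim (<-irrefl refl (≤-trans o<1 1≤o)))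
           (λ o 1+[i∸1]≤o _ → overlapTerm-≡0ˡ n o i (i<2o i o 1≤i 1+[i∸1]≤o)))) ⟩
    sumFrom 1 (n ∸ 1) (λ i → sumFrom 1 (n ∸ 1) (λ o → overlapTerm n o i))
      ≡⟨ sumMap-comm (λ i o → overlapTerm n o i) (applyUpTo (1 +_) (n ∸ 1)) (applyUpTo (1 +_) (n ∸ 1)) ⟩
    sumFrom 1 (n ∸ 1) (λ o → sumFrom 1 (n ∸ 1) (overlapTerm n o))
      ≡⟨ sumFrom-restrict 1 (n ∸ 1) 1 (n / 3) _ ≤-refl
           (+-monoʳ-≤ 1 (≤-pred (subst (n / 3 <_) (sym 1+[n∸1]≡n) (n/d<n n 3 (s≤s (s≤s z≤n)) 1≤n))))
           (λ o 1≤o o<1 → ⊥-elim (<-irrefl refl (≤-trans o<1 1≤o)))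
           (λ o 1+n/3≤o _ → sumFrom-≡0 1 (n ∸ 1) _ (λ i _ _ →
             overlapTerm-≡0-large n o i (≤-trans (s≤s z≤n) 1+n/3≤o) 1+n/3≤o)) ⟩
    sumFrom 1 (n / 3) (λ o → sumFrom 1 (n ∸ 1) (overlapTerm n o))
      ≡⟨ sumFrom-cong 1 (n / 3) (λ o 1≤o o< → sumFrom-overlapTerm-restrict n o 1≤o (≤-pred o<)) ⟩
    sumFrom 1 (n / 3) (λ o → sumFrom (2 * o) (suc (n ∸ o) ∸ 2 * o) (overlapTerm n o)) ∎
    where
    open ≡-Reasoning
    1+[n∸1]≡n : 1 + (n ∸ 1) ≡ n
    1+[n∸1]≡n = m+[n∸m]≡n 1≤n
    i<2o : ∀ i o → 1 ≤ i → 1 + (i ∸ 1) ≤ o → i < 2 * o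
    i<2o i o 1≤i ≤o = ≤-trans (s≤s i≤o) (subst (_≤ 2 * o) (+-comm o 1)
      (+-monoʳ-≤ o (≤-trans 1≤i (≤-trans i≤o (m≤m+n o 0)))))
      where
      i≤o : i ≤ o
      i≤o = subst (_≤ o) (m+[n∸m]≡n 1≤i) ≤o

  [U-u]*∑GG≡overlapTerms : ∀ n o → 1 ≤ o →
    (ℤ.+ U k o ℤ.- ℤ.+ u k o) ℤ.* ∑[ 2 * o ⋯ n ∸ o ] (λ j → G k o j ℤ.* G k o (n ∸ j + o)) ≡
    ℤ.+ sumFrom (2 * o) (suc (n ∸ o) ∸ 2 * o) (overlapTerm n o)
  [U-u]*∑GG≡overlapTerms n o 1≤o = begin
    (ℤ.+ U k o ℤ.- ℤ.+ u k o) ℤ.* ∑GG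
      ≡⟨ cong (ℤ._* ∑GG) (trans (cong (λ c → ℤ.+ c ℤ.- ℤ.+ u k o) (U≡#muDistinct+u o))
                                (+[m+n]-+n≡+m (#muDistinct o) (u k o))) ⟩
    ℤ.+ #muDistinct o ℤ.* ∑GG
      ≡⟨ by-cases (#muDistinct o ℕ.≟ 0) ⟩
    ℤ.+ (#muDistinct o * sumFrom (2 * o) len ∣GG∣)
      ≡⟨ cong ℤ.+_ (sym (sumFrom-*ˡ (2 * o) len (#muDistinct o) ∣GG∣)) ⟩
    ℤ.+ sumFrom (2 * o) len (overlapTerm n o) ∎
    where
    open ≡-Reasoning
    len = suc (n ∸ o) ∸ 2 * o
    ∑GG = ∑[ 2 * o ⋯ n ∸ o ] (λ j → G k o j ℤ.* G k o (n ∸ j + o))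
    ∣GG∣ : ℕ → ℕ
    ∣GG∣ j = ∣G∣ o j * ∣G∣ o (n ∸ j + o)
    -- G k o is a count as soon as some pair (d , g) witnesses #muDistinct o ≢ 0.
    by-cases : Dec (#muDistinct o ≡ 0) → ℤ.+ #muDistinct o ℤ.* ∑GG ≡ ℤ.+ (#muDistinct o * sumFrom (2 * o) len ∣GG∣)
    by-cases (yes none) rewrite none = refl
    by-cases (no some) with Σw≢0⇒∃ o _ some
    ... | d , ld , some′ with Σw≢0⇒∃ o _ some′
    ... | g , lg , some″ = trans
      (cong (ℤ.+ #muDistinct o ℤ.*_) (∑≡sumFrom (2 * o) (n ∸ o) _ ∣GG∣ (λ j _ _ → begin
        G k o j ℤ.* G k o (n ∸ j + o)             ≡⟨ cong₂ ℤ._*_ (G≡+∣G∣ j) (G≡+∣G∣ (n ∸ j + o)) ⟩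
        ℤ.+ ∣G∣ o j ℤ.* ℤ.+ ∣G∣ o (n ∸ j + o)     ≡⟨ sym (ℤ.pos-* (∣G∣ o j) _) ⟩
        ℤ.+ ∣GG∣ j                                 ∎)))
      (sym (ℤ.pos-* (#muDistinct o) _))
      where
      mud = χ≢0⇒ (muDistinct? d g) some″
      G≡+∣G∣ : ∀ m → G k o m ≡ ℤ.+ ∣G∣ o m
      G≡+∣G∣ m = trans (G≡+#unbordered 1≤o ld lg mud m)
                       (cong (ℤ.+_ ∘ ℤ.∣_∣) (sym (G≡+#unbordered 1≤o ld lg mud m)))

  M≡disjoint+overlapping : ∀ n → 1 ≤ n → M k n ≡
    sumFrom 1 (n ∸ 1) (λ i → sumFrom 1 (n ∸ i) (λ j → u k i * u k j * k ^ (2 * n ∸ 2 * (i + j)))) +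
    sumFrom 1 (n / 3) (λ o → sumFrom (2 * o) (suc (n ∸ o) ∸ 2 * o) (overlapTerm n o))
  M≡disjoint+overlapping n 1≤n = begin
    M k n
      ≡⟨ M≡sumFrom² n ⟩
    sumFrom 1 (n ∸ 1) (λ i → sumFrom 1 (n ∸ 1) (#shortestBorders n i))
      ≡⟨ sumFrom-cong 1 (n ∸ 1) (λ i 1≤i i< → sumFrom-#shortestBorders n i 1≤i (i<n i<)) ⟩
    sumFrom 1 (n ∸ 1) (λ i → disjoint i + sumFrom 1 (i ∸ 1) (#overlapping n i))
      ≡⟨ sumFrom-+ 1 (n ∸ 1) disjoint _ ⟩
    sumFrom 1 (n ∸ 1) disjoint + sumFrom 1 (n ∸ 1) (λ i → sumFrom 1 (i ∸ 1) (#overlapping n i))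
      ≡⟨ cong (sumFrom 1 (n ∸ 1) disjoint +_) (trans
           (sumFrom-cong 1 (n ∸ 1) (λ i 1≤i i< → sumFrom-cong 1 (i ∸ 1) (λ o 1≤o o< →
             #overlapping≡overlapTerm n o i 1≤o (subst (o <_) (m+[n∸m]≡n 1≤i) o<) (i<n i<))))
           (sumFrom-overlapTerm-reindex n 1≤n)) ⟩
    sumFrom 1 (n ∸ 1) disjoint + sumFrom 1 (n / 3) (λ o → sumFrom (2 * o) (suc (n ∸ o) ∸ 2 * o) (overlapTerm n o)) ∎
    where
    open ≡-Reasoning
    disjoint : ℕ → ℕ
    disjoint i = sumFrom 1 (n ∸ i) (λ j → u k i * u k j * k ^ (2 * n ∸ 2 * (i + j)))
    i<n : ∀ {i} → i < 1 + (n ∸ 1) → i < n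
    i<n = subst (_ <_) (m+[n∸m]≡n 1≤n)

  M-formula : ∀ n → 1 ≤ n → ℤ.+ M k n ≡
    ∑[ 1 ⋯ n ∸ 1 ] (λ i → ∑[ 1 ⋯ n ∸ i ] (λ j → ℤ.+ (u k i * u k j * k ^ (2 * n ∸ 2 * (i + j)))))
    ℤ.+ ∑[ 1 ⋯ n / 3 ] (λ i → (ℤ.+ U k i ℤ.- ℤ.+ u k i) ℤ.*
          ∑[ 2 * i ⋯ n ∸ i ] (λ j → G k i j ℤ.* G k i (n ∸ j + i)))
  M-formula n 1≤n = trans (cong ℤ.+_ (M≡disjoint+overlapping n 1≤n))
    (trans (ℤ.pos-+ (sumFrom 1 (n ∸ 1) _) _) (sym (cong₂ ℤ._+_
    (∑≡sumFrom 1 (n ∸ 1) _ _ (λ i _ _ → ∑≡sumFrom 1 (n ∸ i) _ _ (λ _ _ _ → refl)))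
    (∑≡sumFrom 1 (n / 3) _ _ (λ o 1≤o _ → [U-u]*∑GG≡overlapTerms n o 1≤o)))))

theorem9 : (k : ℕ) → 1 ≤ k → (n : ℕ) → 1 ≤ n →
    (ℤ.+ M k n ≡
        ∑[ 1 ⋯ n ∸ 1 ] (λ i → ∑[ 1 ⋯ n ∸ i ] (λ j →
           ℤ.+ (u k i * u k j * k ^ (2 * n ∸ 2 * (i + j)))))
        ℤ.+ ∑[ 1 ⋯ n / 3 ] (λ i → (ℤ.+ U k i ℤ.- ℤ.+ u k i) ℤ.*
           ∑[ 2 * i ⋯ n ∸ i ] (λ j → G k i j ℤ.* G k i (n ∸ j + i))))
    × M k 1 ≡ 0
    × (ℤ.+ R k n ≡ ∑[ 1 ⋯ n ∸ 1 ] (λ i → ℤ.+ (k ^ (2 * n ∸ 2 * i) * u k i)) ℤ.- ℤ.+ M k n)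
    × U k n + 2 * R k n + M k n ≡ k ^ (2 * n)
theorem9 k _ n 1≤n = M-formula k n 1≤n , M-1≡0 k , R-formula k n , U+2R+M≡k^[2n] k n
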